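{- Let $p$ be a prime. The subgroup of $\mathbb U_{2p+1}(\mathbb F_p)$ generated by the four matrices $\sigma_1'=\begin{pmatrix}J&0\\0&I_{p+1}\end{pmatrix}$, $\sigma_2'=\sigma_p$, $\sigma_3'=\sigma_{p+1}$, $\sigma_4'=\begin{pmatrix}I_{p+1}&0\\0&J\end{pmatrix}$ is isomorphic to $\tilde{\mathbb U}_5(\mathbb F_p)$.
   Context: $\mathbb U_k(\mathbb F_p)$: upper unitriangular $k\times k$ matrices over $\mathbb F_p$. $\sigma_i=I+E_{i,i+1}$ (identity plus a $1$ in position $(i,i+1)$). $J$ is the $p\times p$ Jordan block with eigenvalue $1$ (ones on the diagonal and superdiagonal). $\tilde{\mathbb U}_5(\mathbb F_p)$: let $R=\mathbb F_p[\mathbb U_2]$ (left multiplication action), $W=R\rtimes\mathbb U_2$ with $(x,h)(x',h')=(x+hx',hh')$, $\tilde G=W\times W$, $M=R\otimes R$ with $((x_1,h_1),(x_2,h_2))\cdot(r\otimes r')=h_1r\otimes h_2r'$; $\tilde{\mathbb U}_5$ is the set $M\times\tilde G$ with product $(u,g)(u',g')=(u+g\cdot u'+x_1\otimes h_2x_2',gg')$ for $g=((x_1,h_1),(x_2,h_2))$, $g'=((x_1',h_1'),(x_2',h_2'))$. -}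

module Defs where

open import Data.Nat using (ℕ; zero; suc; _+_; _*_; _∸_; NonZero; _<ᵇ_; _≤ᵇ_; _≡ᵇ_)
open import Data.Nat.DivMod using (_mod_)
open import Data.Fin using (Fin; toℕ)
open import Data.Bool using (Bool; true; false; if_then_else_; _∧_)
open import Data.Vec using (Vec; lookup; tabulate; foldr′)
open import Data.Product using (_×_; _,_)
open import Relation.Binary.PropositionalEquality using (_≡_)

module _ (p : ℕ) .{{nz : NonZero p}} where

  Fp : Set
  Fp = Fin p

  0F 1F : Fp
  0F = 0 mod p
  1F = 1 mod p

  _+F_ _*F_ _-F_ : Fp → Fp → Fp
  a +F b = (toℕ a + toℕ b) mod p
  a *F b = (toℕ a * toℕ b) mod p
  a -F b = (toℕ a + (p ∸ toℕ b)) mod p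

  Mat : ℕ → Set
  Mat n = Vec (Vec Fp n) n

  entry : ∀ {n} → Mat n → Fin n → Fin n → Fp
  entry A i j = lookup (lookup A i) j

  _⊗_ : ∀ {n} → Mat n → Mat n → Mat n
  _⊗_ {n} A B = tabulate λ i → tabulate λ j →
    foldr′ _+F_ 0F (tabulate {n = n} λ k → entry A i k *F entry B k j)

  Id : ∀ n → Mat n
  Id n = tabulate λ i → tabulate λ j →
    if toℕ i ≡ᵇ toℕ j then 1F else 0F

  unitSup : ∀ n → (ℕ → Bool) → Mat n
  unitSup n S = tabulate λ i → tabulate λ j →
    if toℕ i ≡ᵇ toℕ j then 1F
    else (if (toℕ j ≡ᵇ suc (toℕ i)) ∧ S (toℕ i) then 1F else 0F)

  -- σ_i = I + E_{i,i+1}, with 1-based index i as in the paper.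
  σ : ∀ n → ℕ → Mat n
  σ n i = unitSup n (λ k → suc k ≡ᵇ i)

  N : ℕ
  N = 2 * p + 1

  -- σ₁' = diag(J, I_{p+1}) : superdiagonal ones at 0-based (k,k+1), k+1 < p.
  σ₁' : Mat N
  σ₁' = unitSup N (λ k → suc k <ᵇ p)

  σ₂' : Mat N
  σ₂' = σ N p

  σ₃' : Mat N
  σ₃' = σ N (suc p)

  -- σ₄' = diag(I_{p+1}, J) : superdiagonal ones at 0-based (k,k+1), k ≥ p+1.
  σ₄' : Mat N
  σ₄' = unitSup N (λ k → suc p ≤ᵇ k)

  gens : Fin 4 → Mat N
  gens Fin.zero = σ₁'
  gens (Fin.suc Fin.zero) = σ₂'
  gens (Fin.suc (Fin.suc Fin.zero)) = σ₃'
  gens (Fin.suc (Fin.suc (Fin.suc Fin.zero))) = σ₄'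

  -- The subgroup of GL_N(F_p) (inside U_N(F_p)) generated by σ₁',…,σ₄':
  -- the smallest set containing the generators and the identity, closed
  -- under products and inverses (B is the inverse of A when A B = I).
  data Gen : Mat N → Set where
    gen : ∀ k → Gen (gens k)
    one : Gen (Id N)
    mul : ∀ {A B} → Gen A → Gen B → Gen (A ⊗ B)
    inv : ∀ {A B} → Gen A → A ⊗ B ≡ Id N → Gen B

  -- The group Ũ₅(F_p).
  -- U₂(F_p): the matrix [[1,a],[0,1]] is recorded by a ∈ F_p;
  -- matrix multiplication corresponds to addition of a.
  U2 : Set
  U2 = Fp

  _·U_ : U2 → U2 → U2
  _·U_ = _+F_

  -- R = F_p[U₂]: an element Σ_g r_g g is its coefficient vector (r_g)_g.
  R : Set
  R = Vec Fp p

  _+R_ : R → R → R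
  r +R s = tabulate λ g → lookup r g +F lookup s g

  -- left multiplication by h ∈ U₂: h·(Σ r_g g) = Σ r_g (hg), so the
  -- coefficient of g in h·r is r_{h⁻¹ g}.
  _▷R_ : U2 → R → R
  h ▷R r = tabulate λ g → lookup r (g -F h)

  W : Set
  W = R × U2

  _·W_ : W → W → W
  (x , h) ·W (x' , h') = (x +R (h ▷R x')) , (h ·U h')

  G̃ : Set
  G̃ = W × W

  _·G_ : G̃ → G̃ → G̃
  (a , b) ·G (a' , b') = (a ·W a') , (b ·W b')

  -- M = R ⊗ R ≅ F_p[U₂ × U₂]: an element is its coefficient matrix
  -- (m_{g,g'}); r ⊗ r' has coefficients r_g r'_{g'}.
  M : Set
  M = Vec (Vec Fp p) p

  _+M_ : M → M → M
  m +M n = tabulate λ g → tabulate λ g' →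
    lookup (lookup m g) g' +F lookup (lookup n g) g'

  _⊠_ : R → R → M
  r ⊠ r' = tabulate λ g → tabulate λ g' → lookup r g *F lookup r' g'

  -- ((x₁,h₁),(x₂,h₂))·(r ⊗ r') = h₁r ⊗ h₂r', extended linearly.
  _▷M_ : G̃ → M → M
  ((_ , h₁) , (_ , h₂)) ▷M m = tabulate λ g → tabulate λ g' →
    lookup (lookup m (g -F h₁)) (g' -F h₂)

  Ũ₅ : Set
  Ũ₅ = M × G̃

  _·Ũ_ : Ũ₅ → Ũ₅ → Ũ₅
  (u , g@((x₁ , h₁) , (x₂ , h₂))) ·Ũ (u' , g'@((x₁' , h₁') , (x₂' , h₂'))) =
    ((u +M (g ▷M u')) +M (x₁ ⊠ (h₂ ▷R x₂'))) , (g ·G g')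

module Submission where

-- Split the 2p+1 indices as p + 1 + p.  An element a = (u, (x₁,h₁), (x₂,h₂)) of Ũ₅
-- acts faithfully on F_p[U₂] ⊕ F_p ⊕ F_p[U₂] by a block upper triangular matrix
-- ρ(a), with the translations P(h₁), 1, P(h₂) on the diagonal (U₂ ≅ F_p).  The
-- binomial matrix Bin(i,g) = C(g, p-1-i) is invertible (binomial inversion) and
-- satisfies Bin P(1) = J Bin by Pascal's rule, using p ∣ C(p,k) where g+1 wraps
-- around.  Hence φ(a) = Q ρ(a) Q⁻¹ with Q = diag(Bin, 1, Bin) is an injective
-- homomorphism mapping four elements g₁,…,g₄ of Ũ₅ to σ'₁,…,σ'₄, so its image
-- contains the generated subgroup.  Conversely g₁,…,g₄ generate Ũ₅: translations
-- are multiples of g₁, g₄; conjugates of g₂, g₃ span the x-parts; commutators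
-- X x Y y X(-x) Y(-y) span the u-part.

open import Defs
open import Data.Nat using (ℕ; NonZero; zero; suc; _<_; _∸_; _≡ᵇ_; s≤s; z≤n)
import Data.Nat as ℕ
import Data.Nat.Properties as ℕ
open import Data.Nat.DivMod using (_mod_; _%_; %-distribˡ-+; %-distribˡ-*; m<n⇒m%n≡m; n%n≡0)
open import Data.Nat.Divisibility using (_∣_; divides; ∣⇒≤)
open import Data.Nat.Primality using (Prime; euclidsLemma; prime⇒nonTrivial)
open import Data.Nat.Tactic.RingSolver using (solve-∀)
open import Data.Fin using (Fin; toℕ; zero; suc; _↑ˡ_; _↑ʳ_; cast; splitAt; fromℕ<)
import Data.Fin.Properties as Fin
open import Data.Fin.Properties using (toℕ-injective; toℕ-fromℕ<; toℕ<n; cast-is-id; cast-involutive;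
  splitAt-↑ˡ; splitAt-↑ʳ; splitAt⁻¹-↑ˡ; splitAt⁻¹-↑ʳ; toℕ-cast; toℕ-↑ˡ; toℕ-↑ʳ)
open import Data.Vec using (Vec; []; _∷_; lookup; tabulate; foldr′)
open import Data.Vec.Properties using (lookup∘tabulate; tabulate∘lookup; tabulate-cong)
open import Data.Bool using (Bool; true; false; T; if_then_else_; _∧_)
open import Data.Product using (Σ; ∃; _×_; _,_)
open import Data.Sum using (_⊎_; inj₁; inj₂)
open import Data.Empty using (⊥-elim)
open import Function using (_∘_; _on_)
open import Function.Bundles using (_⇔_; mk⇔)
open import Relation.Nullary using (Dec; yes; no; ¬_)
open import Relation.Binary.PropositionalEquality
  using (_≡_; _≢_; refl; sym; trans; cong; cong₂; subst; subst₂; isEquivalence; module ≡-Reasoning)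
open import Algebra.Bundles using (CommutativeRing)

p+1+p≡2p+1 : ∀ p → p ℕ.+ suc p ≡ 2 ℕ.* p ℕ.+ 1
p+1+p≡2p+1 = solve-∀

-- The regrouping behind (-1)^(m+j) = (-1)^(m+n) (-1)^(n+j).
regroup-ℕ : ∀ m n j → (m ℕ.+ j) ℕ.+ (n ℕ.+ n) ≡ (m ℕ.+ n) ℕ.+ (n ℕ.+ j)
regroup-ℕ = solve-∀

∸-suc-pred : ∀ {m n} → suc n ℕ.≤ m → m ∸ n ≡ suc (m ∸ suc n)
∸-suc-pred {suc m} {zero}  _         = refl
∸-suc-pred {suc m} {suc n} (s≤s n<m) = ∸-suc-pred n<m

infix 8 _choose_
_choose_ : ℕ → ℕ → ℕ
n     choose zero  = 1
zero  choose suc k = 0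
suc n choose suc k = n choose k ℕ.+ n choose suc k

choose-< : ∀ {n k} → n < k → n choose k ≡ 0
choose-< {zero}  {suc k} _         = refl
choose-< {suc n} {suc k} (s≤s n<k) = cong₂ ℕ._+_ (choose-< n<k) (choose-< (ℕ.m<n⇒m<1+n n<k))

choose-self : ∀ n → n choose n ≡ 1
choose-self zero    = refl
choose-self (suc n) = cong₂ ℕ._+_ (choose-self n) (choose-< (ℕ.n<1+n n))

choose-1 : ∀ n → n choose 1 ≡ n
choose-1 zero    = refl
choose-1 (suc n) = cong suc (choose-1 n)

absorption : ∀ n k → suc k ℕ.* (suc n choose suc k) ≡ suc n ℕ.* (n choose k)
absorption zero    zero    = refl
absorption zero    (suc k) = ℕ.*-zeroʳ (suc (suc k))
absorption (suc n) zero    =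
  trans (ℕ.+-identityʳ _) (trans (cong suc (choose-1 (suc n))) (sym (ℕ.*-identityʳ (suc (suc n)))))
absorption (suc n) (suc k) = begin
  suc (suc k) ℕ.* (suc n choose suc k ℕ.+ suc n choose suc (suc k))
    ≡⟨ ℕ.*-distribˡ-+ (suc (suc k)) (suc n choose suc k) _ ⟩
  suc (suc k) ℕ.* (suc n choose suc k) ℕ.+ suc (suc k) ℕ.* (suc n choose suc (suc k))
    ≡⟨ cong (suc (suc k) ℕ.* (suc n choose suc k) ℕ.+_) (absorption n (suc k)) ⟩
  suc n choose suc k ℕ.+ suc k ℕ.* (suc n choose suc k) ℕ.+ suc n ℕ.* (n choose suc k)
    ≡⟨ cong (λ z → suc n choose suc k ℕ.+ z ℕ.+ suc n ℕ.* (n choose suc k)) (absorption n k) ⟩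
  suc n choose suc k ℕ.+ suc n ℕ.* (n choose k) ℕ.+ suc n ℕ.* (n choose suc k)
    ≡⟨ ℕ.+-assoc (suc n choose suc k) _ _ ⟩
  suc n choose suc k ℕ.+ (suc n ℕ.* (n choose k) ℕ.+ suc n ℕ.* (n choose suc k))
    ≡⟨ cong (suc n choose suc k ℕ.+_) (ℕ.*-distribˡ-+ (suc n) (n choose k) _) ⟨
  suc (suc n) ℕ.* (suc n choose suc k) ∎
  where open ≡-Reasoning

-- A prime q divides C(q, k) for 0 < k < q: by absorption q divides
-- k C(q,k), and q does not divide k.
prime∣choose : ∀ q k → Prime (suc q) → suc k < suc q → suc q ∣ suc q choose suc k
prime∣choose q k q-prime k<q
  with euclidsLemma (suc k) (suc q choose suc k) q-prime
         (subst (suc q ∣_) (sym (absorption q k)) (divides (q choose k) (ℕ.*-comm (suc q) _)))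
... | inj₁ q∣k = ⊥-elim (ℕ.<⇒≱ k<q (∣⇒≤ q∣k))
... | inj₂ q∣C = q∣C

module Span {A : Set} (z : A) (_⊕_ : A → A → A)
            (identityˡ : ∀ a → z ⊕ a ≡ a) (identityʳ : ∀ a → a ⊕ z ≡ a) where

  single : ∀ {n} → Fin n → A → Vec A n
  single c a = tabulate λ g → if toℕ c ≡ᵇ toℕ g then a else z

  span : ∀ n (P : Vec A n → Set) →
    P (tabulate (λ _ → z)) →
    (∀ v w → P v → P w → P (tabulate λ g → lookup v g ⊕ lookup w g)) →
    (∀ c a → P (single c a)) →
    ∀ v → P v
  span zero    P P-zero P-⊕ P-single []       = P-zero
  span (suc n) P P-zero P-⊕ P-single (x ∷ xs) =
    subst P head+tail (P-⊕ (single zero x) (z ∷ xs) (P-single zero x) tail)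
    where
    -- x ∷ xs is (x, 0, …, 0) plus (0 ∷ xs), and the vectors 0 ∷ v are
    -- handled by induction.
    head+tail : (tabulate λ g → lookup (single zero x) g ⊕ lookup (z ∷ xs) g) ≡ x ∷ xs
    head+tail = cong₂ _∷_ (identityʳ x)
      (trans (tabulate-cong (λ g → trans (cong (_⊕ lookup xs g) (lookup∘tabulate _ g)) (identityˡ (lookup xs g))))
             (tabulate∘lookup xs))
    tail : P (z ∷ xs)
    tail = span n (P ∘ (z ∷_)) P-zero
      (λ v w Pv Pw → subst (λ a → P (a ∷ _)) (identityˡ z) (P-⊕ (z ∷ v) (z ∷ w) Pv Pw))
      (λ c a → P-single (suc c) a) xs

module _ (p : ℕ) .{{nz : NonZero p}} where

  -- The ring operations of Defs, sealed so that normalisation never unfolds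
  -- `mod`; everything about them is derived from the defining equations.
  infixl 6 _+_ _-_
  infixl 7 _*_
  opaque
    _+_ _*_ _-_ : Fp p → Fp p → Fp p
    _+_ = _+F_ p
    _*_ = _*F_ p
    _-_ = _-F_ p

    +-def : ∀ a b → a + b ≡ _+F_ p a b
    +-def a b = refl
    *-def : ∀ a b → a * b ≡ _*F_ p a b
    *-def a b = refl
    -‿def : ∀ a b → a - b ≡ _-F_ p a b
    -‿def a b = refl

  0# 1# : Fp p
  0# = 0F p
  1# = 1F p

  -_ : Fp p → Fp p
  - a = 0# - a

  -- Reduction mod p, ℕ → F_p; it is a surjective semiring homomorphism,
  -- which reduces every ring law of F_p to the corresponding law of ℕ.
  [_] : ℕ → Fp p
  [ m ] = m mod p

  [toℕ] : ∀ a → [ toℕ a ] ≡ a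
  [toℕ] a = toℕ-injective (trans (toℕ-fromℕ< _) (m<n⇒m%n≡m (toℕ<n a)))

  []-cong : ∀ {m n} → m % p ≡ n % p → [ m ] ≡ [ n ]
  []-cong {m} {n} e = toℕ-injective (trans (toℕ-fromℕ< _) (trans e (sym (toℕ-fromℕ< _))))

  toℕ[] : ∀ m → toℕ [ m ] ≡ m % p
  toℕ[] m = toℕ-fromℕ< _

  []-+ : ∀ m n → [ m ℕ.+ n ] ≡ [ m ] + [ n ]
  []-+ m n = begin
    [ m ℕ.+ n ]                      ≡⟨ []-cong (%-distribˡ-+ m n p) ⟩
    [ m % p ℕ.+ n % p ]              ≡⟨ sym (cong₂ (λ x y → [ x ℕ.+ y ]) (toℕ[] m) (toℕ[] n)) ⟩
    _+F_ p [ m ] [ n ]               ≡⟨ sym (+-def [ m ] [ n ]) ⟩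
    [ m ] + [ n ]                    ∎
    where open ≡-Reasoning

  []-* : ∀ m n → [ m ℕ.* n ] ≡ [ m ] * [ n ]
  []-* m n = begin
    [ m ℕ.* n ]                      ≡⟨ []-cong (%-distribˡ-* m n p) ⟩
    [ m % p ℕ.* (n % p) ]            ≡⟨ sym (cong₂ (λ x y → [ x ℕ.* y ]) (toℕ[] m) (toℕ[] n)) ⟩
    _*F_ p [ m ] [ n ]               ≡⟨ sym (*-def [ m ] [ n ]) ⟩
    [ m ] * [ n ]                    ∎
    where open ≡-Reasoning

  [p]≡0 : [ p ] ≡ 0#
  [p]≡0 = []-cong (trans (n%n≡0 p) (sym (m<n⇒m%n≡m (ℕ.>-nonZero⁻¹ p))))

  toℕ-0# : toℕ 0# ≡ 0
  toℕ-0# = trans (toℕ[] 0) (m<n⇒m%n≡m (ℕ.>-nonZero⁻¹ p))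

  -‿[] : ∀ a b → a - b ≡ a + [ p ℕ.∸ toℕ b ]
  -‿[] a b = trans (-‿def a b) (trans ([]-+ (toℕ a) (p ℕ.∸ toℕ b)) (cong (_+ _) ([toℕ] a)))

  neg-[] : ∀ a → - a ≡ [ p ℕ.∸ toℕ a ]
  neg-[] a = trans (-‿def 0# a) (cong (λ z → [ z ℕ.+ (p ℕ.∸ toℕ a) ]) toℕ-0#)

  []-elim : {P : Fp p → Set} → (∀ m → P [ m ]) → ∀ a → P a
  []-elim {P} h a = subst P ([toℕ] a) (h (toℕ a))

  +-assoc : ∀ a b c → (a + b) + c ≡ a + (b + c)
  +-assoc = []-elim λ x → []-elim λ y → []-elim λ z → begin
    ([ x ] + [ y ]) + [ z ]   ≡⟨ cong (_+ [ z ]) ([]-+ x y) ⟨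
    [ x ℕ.+ y ] + [ z ]       ≡⟨ []-+ (x ℕ.+ y) z ⟨
    [ x ℕ.+ y ℕ.+ z ]         ≡⟨ cong [_] (ℕ.+-assoc x y z) ⟩
    [ x ℕ.+ (y ℕ.+ z) ]       ≡⟨ []-+ x (y ℕ.+ z) ⟩
    [ x ] + [ y ℕ.+ z ]       ≡⟨ cong ([ x ] +_) ([]-+ y z) ⟩
    [ x ] + ([ y ] + [ z ])   ∎
    where open ≡-Reasoning

  *-assoc : ∀ a b c → (a * b) * c ≡ a * (b * c)
  *-assoc = []-elim λ x → []-elim λ y → []-elim λ z → begin
    ([ x ] * [ y ]) * [ z ]   ≡⟨ cong (_* [ z ]) ([]-* x y) ⟨
    [ x ℕ.* y ] * [ z ]       ≡⟨ []-* (x ℕ.* y) z ⟨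
    [ x ℕ.* y ℕ.* z ]         ≡⟨ cong [_] (ℕ.*-assoc x y z) ⟩
    [ x ℕ.* (y ℕ.* z) ]       ≡⟨ []-* x (y ℕ.* z) ⟩
    [ x ] * [ y ℕ.* z ]       ≡⟨ cong ([ x ] *_) ([]-* y z) ⟩
    [ x ] * ([ y ] * [ z ])   ∎
    where open ≡-Reasoning

  *-distribˡ-+ : ∀ a b c → a * (b + c) ≡ a * b + a * c
  *-distribˡ-+ = []-elim λ x → []-elim λ y → []-elim λ z → begin
    [ x ] * ([ y ] + [ z ])         ≡⟨ cong ([ x ] *_) ([]-+ y z) ⟨
    [ x ] * [ y ℕ.+ z ]             ≡⟨ []-* x (y ℕ.+ z) ⟨
    [ x ℕ.* (y ℕ.+ z) ]             ≡⟨ cong [_] (ℕ.*-distribˡ-+ x y z) ⟩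
    [ x ℕ.* y ℕ.+ x ℕ.* z ]         ≡⟨ []-+ (x ℕ.* y) (x ℕ.* z) ⟩
    [ x ℕ.* y ] + [ x ℕ.* z ]       ≡⟨ cong₂ _+_ ([]-* x y) ([]-* x z) ⟩
    [ x ] * [ y ] + [ x ] * [ z ]   ∎
    where open ≡-Reasoning

  +-comm : ∀ a b → a + b ≡ b + a
  +-comm = []-elim λ x → []-elim λ y →
    trans (sym ([]-+ x y)) (trans (cong [_] (ℕ.+-comm x y)) ([]-+ y x))

  *-comm : ∀ a b → a * b ≡ b * a
  *-comm = []-elim λ x → []-elim λ y →
    trans (sym ([]-* x y)) (trans (cong [_] (ℕ.*-comm x y)) ([]-* y x))

  +-identityˡ : ∀ a → 0# + a ≡ a
  +-identityˡ = []-elim λ x → sym ([]-+ 0 x)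

  *-identityˡ : ∀ a → 1# * a ≡ a
  *-identityˡ = []-elim λ x → trans (sym ([]-* 1 x)) (cong [_] (ℕ.*-identityˡ x))

  -‿inverseˡ : ∀ a → - a + a ≡ 0#
  -‿inverseˡ a = begin
    - a + a                             ≡⟨ cong₂ _+_ (neg-[] a) (sym ([toℕ] a)) ⟩
    [ p ℕ.∸ toℕ a ] + [ toℕ a ]         ≡⟨ []-+ (p ℕ.∸ toℕ a) (toℕ a) ⟨
    [ p ℕ.∸ toℕ a ℕ.+ toℕ a ]           ≡⟨ cong [_] (ℕ.m∸n+n≡m (ℕ.<⇒≤ (toℕ<n a))) ⟩
    [ p ]                               ≡⟨ [p]≡0 ⟩
    0#                                  ∎
    where open ≡-Reasoning

  -‿≡+- : ∀ a b → a - b ≡ a + - b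
  -‿≡+- a b = trans (-‿[] a b) (cong (a +_) (sym (neg-[] b)))

  Fp-ring : CommutativeRing _ _
  Fp-ring = record
    { isCommutativeRing = record
      { isRing = record
        { +-isAbelianGroup = record
          { isGroup = record
            { isMonoid = record
              { isSemigroup = record
                { isMagma = record { isEquivalence = isEquivalence ; ∙-cong = cong₂ _+_ }
                ; assoc = +-assoc }
              ; identity = +-identityˡ , λ a → trans (+-comm a 0#) (+-identityˡ a) }
            ; inverse = -‿inverseˡ , λ a → trans (+-comm a (- a)) (-‿inverseˡ a)
            ; ⁻¹-cong = cong (λ a → - a) }
          ; comm = +-comm }
        ; *-cong = cong₂ _*_
        ; *-assoc = *-assoc
        ; *-identity = *-identityˡ , λ a → trans (*-comm a 1#) (*-identityˡ a)
        ; distrib = *-distribˡ-+ , λ a b c → trans (*-comm (b + c) a)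
                      (trans (*-distribˡ-+ a b c) (cong₂ _+_ (*-comm a b) (*-comm a c))) }
      ; *-comm = *-comm } }

  open CommutativeRing Fp-ring public
    using (+-identityʳ; *-identityʳ; -‿inverseʳ; distribʳ; zeroˡ; zeroʳ;
           +-commutativeSemigroup; ring)
  open import Algebra.Properties.Ring ring public
    using (-‿distribˡ-*; -‿distribʳ-*; -‿involutive; -‿+-comm; -0#≈0#)
  open import Algebra.Properties.CommutativeSemigroup +-commutativeSemigroup public
    using (interchange; x∙yz≈y∙xz; x∙yz≈zx∙y; xy∙z≈xz∙y)

  *-zero-by : ∀ a {b} → b ≡ 0# → a * b ≡ 0#
  *-zero-by a refl = zeroʳ a

  +-zero-by : ∀ a {b} → b ≡ 0# → a + b ≡ a
  +-zero-by a refl = +-identityʳ a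

  zero-+ : ∀ {a} b → a ≡ 0# → a + b ≡ b
  zero-+ b refl = +-identityˡ b

  δℕ : ℕ → ℕ → Fp p
  δℕ m n = if m ≡ᵇ n then 1# else 0#

  -- On Fin n this is exactly the entry of Defs.Id.
  δ : ∀ {n} → Fin n → Fin n → Fp p
  δ i j = δℕ (toℕ i) (toℕ j)

  δℕ-refl : ∀ m → δℕ m m ≡ 1#
  δℕ-refl zero = refl
  δℕ-refl (suc m) = δℕ-refl m

  δℕ-≢ : ∀ {m n} → m ≢ n → δℕ m n ≡ 0#
  δℕ-≢ {zero} {zero} ne = ⊥-elim (ne refl)
  δℕ-≢ {zero} {suc n} ne = refl
  δℕ-≢ {suc m} {zero} ne = refl
  δℕ-≢ {suc m} {suc n} ne = δℕ-≢ (ne ∘ cong suc)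

  δℕ-sym : ∀ m n → δℕ m n ≡ δℕ n m
  δℕ-sym zero zero = refl
  δℕ-sym zero (suc n) = refl
  δℕ-sym (suc m) zero = refl
  δℕ-sym (suc m) (suc n) = δℕ-sym m n

  δℕ-+ : ∀ k m n → δℕ (k ℕ.+ m) (k ℕ.+ n) ≡ δℕ m n
  δℕ-+ zero m n = refl
  δℕ-+ (suc k) m n = δℕ-+ k m n

  δ-refl : ∀ {n} (i : Fin n) → δ i i ≡ 1#
  δ-refl i = δℕ-refl (toℕ i)

  δ-≢ : ∀ {n} {i j : Fin n} → i ≢ j → δ i j ≡ 0#
  δ-≢ ne = δℕ-≢ (ne ∘ toℕ-injective)

  δ-sym : ∀ {n} (i j : Fin n) → δ i j ≡ δ j i
  δ-sym i j = δℕ-sym (toℕ i) (toℕ j)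

  ∑ : ∀ n → (Fin n → Fp p) → Fp p
  ∑ zero f = 0#
  ∑ (suc n) f = f zero + ∑ n (f ∘ suc)

  ∑-foldr : ∀ n (f : Fin n → Fp p) → foldr′ (_+F_ p) (0F p) (tabulate f) ≡ ∑ n f
  ∑-foldr zero f = refl
  ∑-foldr (suc n) f = trans (cong (_+F_ p (f zero)) (∑-foldr n (f ∘ suc))) (sym (+-def _ _))

  ∑-cong : ∀ n {f g : Fin n → Fp p} → (∀ k → f k ≡ g k) → ∑ n f ≡ ∑ n g
  ∑-cong zero e = refl
  ∑-cong (suc n) e = cong₂ _+_ (e zero) (∑-cong n (e ∘ suc))

  ∑-zero : ∀ n {f : Fin n → Fp p} → (∀ k → f k ≡ 0#) → ∑ n f ≡ 0#
  ∑-zero zero e = refl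
  ∑-zero (suc n) e = trans (cong₂ _+_ (e zero) (∑-zero n (e ∘ suc))) (+-identityˡ 0#)

  ∑-+ : ∀ n (f g : Fin n → Fp p) → ∑ n (λ k → f k + g k) ≡ ∑ n f + ∑ n g
  ∑-+ zero f g = sym (+-identityˡ 0#)
  ∑-+ (suc n) f g = trans (cong (f zero + g zero +_) (∑-+ n (f ∘ suc) (g ∘ suc)))
                          (interchange (f zero) (g zero) (∑ n (f ∘ suc)) (∑ n (g ∘ suc)))

  ∑-*ˡ : ∀ n c (f : Fin n → Fp p) → c * ∑ n f ≡ ∑ n (λ k → c * f k)
  ∑-*ˡ zero c f = zeroʳ c
  ∑-*ˡ (suc n) c f = trans (*-distribˡ-+ c _ _) (cong (c * f zero +_) (∑-*ˡ n c (f ∘ suc)))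

  ∑-*ʳ : ∀ n c (f : Fin n → Fp p) → ∑ n f * c ≡ ∑ n (λ k → f k * c)
  ∑-*ʳ n c f = trans (*-comm _ c) (trans (∑-*ˡ n c f) (∑-cong n (λ k → *-comm c (f k))))

  ∑-swap : ∀ m n (f : Fin m → Fin n → Fp p) →
    ∑ m (λ i → ∑ n (f i)) ≡ ∑ n (λ j → ∑ m (λ i → f i j))
  ∑-swap zero n f = sym (∑-zero n (λ _ → refl))
  ∑-swap (suc m) n f = trans (cong (∑ n (f zero) +_) (∑-swap m n (f ∘ suc)))
                             (sym (∑-+ n (f zero) (λ j → ∑ m (λ i → f (suc i) j))))

  ∑-split : ∀ m n (f : Fin (m ℕ.+ n) → Fp p) →
    ∑ (m ℕ.+ n) f ≡ ∑ m (λ i → f (i ↑ˡ n)) + ∑ n (λ j → f (m ↑ʳ j))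
  ∑-split zero n f = sym (+-identityˡ _)
  ∑-split (suc m) n f = trans (cong (f zero +_) (∑-split m n (f ∘ suc))) (sym (+-assoc (f zero) _ _))

  ∑-cast : ∀ {m n} (e : m ≡ n) (f : Fin n → Fp p) → ∑ n f ≡ ∑ m (f ∘ cast e)
  ∑-cast {m} refl f = ∑-cong m (λ k → cong f (sym (cast-is-id refl k)))

  ∑-δˡ : ∀ n (i : Fin n) (f : Fin n → Fp p) → ∑ n (λ k → δ i k * f k) ≡ f i
  ∑-δˡ (suc n) zero f = begin
    1# * f zero + ∑ n (λ k → 0# * f (suc k))
      ≡⟨ cong₂ _+_ (*-identityˡ _) (∑-zero n (zeroˡ ∘ f ∘ suc)) ⟩
    f zero + 0#                                ≡⟨ +-identityʳ _ ⟩
    f zero                                     ∎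
    where open ≡-Reasoning
  ∑-δˡ (suc n) (suc i) f = begin
    0# * f zero + ∑ n (λ k → δ i k * f (suc k))  ≡⟨ cong₂ _+_ (zeroˡ _) (∑-δˡ n i (f ∘ suc)) ⟩
    0# + f (suc i)                               ≡⟨ +-identityˡ _ ⟩
    f (suc i)                                    ∎
    where open ≡-Reasoning

  ∑-δʳ : ∀ n (i : Fin n) (f : Fin n → Fp p) → ∑ n (λ k → f k * δ k i) ≡ f i
  ∑-δʳ n i f = trans (∑-cong n (λ k → trans (*-comm (f k) _) (cong (_* f k) (δ-sym k i)))) (∑-δˡ n i f)

  -- Sums over an initial segment of ℕ; used for binomial identities, where
  -- the summation index takes part in arithmetic.
  ∑ℕ : ℕ → (ℕ → Fp p) → Fp p
  ∑ℕ zero g = 0#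
  ∑ℕ (suc n) g = g 0 + ∑ℕ n (g ∘ suc)

  ∑-toℕ : ∀ n (g : ℕ → Fp p) → ∑ n (g ∘ toℕ) ≡ ∑ℕ n g
  ∑-toℕ zero g = refl
  ∑-toℕ (suc n) g = cong (g 0 +_) (∑-toℕ n (g ∘ suc))

  ∑ℕ-cong : ∀ n {f g : ℕ → Fp p} → (∀ m → m < n → f m ≡ g m) → ∑ℕ n f ≡ ∑ℕ n g
  ∑ℕ-cong zero e = refl
  ∑ℕ-cong (suc n) e = cong₂ _+_ (e 0 (s≤s z≤n)) (∑ℕ-cong n (λ m lt → e (suc m) (s≤s lt)))

  ∑ℕ-zero : ∀ n {f : ℕ → Fp p} → (∀ m → m < n → f m ≡ 0#) → ∑ℕ n f ≡ 0#
  ∑ℕ-zero zero e = refl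
  ∑ℕ-zero (suc n) e =
    trans (cong₂ _+_ (e 0 (s≤s z≤n)) (∑ℕ-zero n (λ m lt → e (suc m) (s≤s lt)))) (+-identityˡ 0#)

  ∑ℕ-snoc : ∀ n g → ∑ℕ (suc n) g ≡ ∑ℕ n g + g n
  ∑ℕ-snoc zero g = trans (+-identityʳ (g 0)) (sym (+-identityˡ (g 0)))
  ∑ℕ-snoc (suc n) g = trans (cong (g 0 +_) (∑ℕ-snoc n (g ∘ suc))) (sym (+-assoc (g 0) _ _))

  ∑ℕ-+ : ∀ n f g → ∑ℕ n (λ m → f m + g m) ≡ ∑ℕ n f + ∑ℕ n g
  ∑ℕ-+ zero f g = sym (+-identityˡ 0#)
  ∑ℕ-+ (suc n) f g = trans (cong (f 0 + g 0 +_) (∑ℕ-+ n (f ∘ suc) (g ∘ suc)))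
                           (interchange (f 0) (g 0) (∑ℕ n (f ∘ suc)) (∑ℕ n (g ∘ suc)))

  ∑ℕ-*ˡ : ∀ n c g → c * ∑ℕ n g ≡ ∑ℕ n (λ m → c * g m)
  ∑ℕ-*ˡ zero c g = zeroʳ c
  ∑ℕ-*ˡ (suc n) c g = trans (*-distribˡ-+ c (g 0) _) (cong (c * g 0 +_) (∑ℕ-*ˡ n c (g ∘ suc)))

  ∑ℕ-neg : ∀ n g → ∑ℕ n (λ m → - g m) ≡ - ∑ℕ n g
  ∑ℕ-neg zero g = sym -0#≈0#
  ∑ℕ-neg (suc n) g = trans (cong (- g 0 +_) (∑ℕ-neg n (g ∘ suc))) (-‿+-comm (g 0) _)

  ∑ℕ-reverse : ∀ n g → ∑ℕ n (λ m → g (n ∸ suc m)) ≡ ∑ℕ n g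
  ∑ℕ-reverse zero g = refl
  ∑ℕ-reverse (suc n) g = begin
    g n + ∑ℕ n (λ m → g (n ∸ suc m))   ≡⟨ cong (g n +_) (∑ℕ-reverse n g) ⟩
    g n + ∑ℕ n g                        ≡⟨ +-comm (g n) _ ⟩
    ∑ℕ n g + g n                        ≡⟨ ∑ℕ-snoc n g ⟨
    ∑ℕ (suc n) g                        ∎
    where open ≡-Reasoning

  ∑ℕ-δ : ∀ n c (f : ℕ → Fp p) → c < n → ∑ℕ n (λ m → δℕ m c * f m) ≡ f c
  ∑ℕ-δ (suc n) zero f lt =
    trans (cong₂ _+_ (*-identityˡ (f 0)) (∑ℕ-zero n (λ m _ → zeroˡ (f (suc m))))) (+-identityʳ (f 0))
  ∑ℕ-δ (suc n) (suc c) f (s≤s lt) =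
    trans (cong₂ _+_ (zeroˡ (f 0)) (∑ℕ-δ n c (f ∘ suc) lt)) (+-identityˡ (f (suc c)))

  infixl 7 _⊗ₘ_
  _⊗ₘ_ : ∀ {n} → Mat p n → Mat p n → Mat p n
  _⊗ₘ_ = _⊗_ p

  ent : ∀ {n} → Mat p n → Fin n → Fin n → Fp p
  ent = entry p

  mkMat : ∀ {n} → (Fin n → Fin n → Fp p) → Mat p n
  mkMat f = tabulate λ i → tabulate λ j → f i j

  vec-ext : ∀ {A : Set} {n} {xs ys : Vec A n} → (∀ i → lookup xs i ≡ lookup ys i) → xs ≡ ys
  vec-ext {xs = xs} {ys} e = trans (sym (tabulate∘lookup xs)) (trans (tabulate-cong e) (tabulate∘lookup ys))

  Mat-ext : ∀ {n} {A B : Mat p n} → (∀ i j → ent A i j ≡ ent B i j) → A ≡ B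
  Mat-ext e = vec-ext (λ i → vec-ext (e i))

  ent-mkMat : ∀ {n} (f : Fin n → Fin n → Fp p) i j → ent (mkMat f) i j ≡ f i j
  ent-mkMat f i j = trans (cong (λ v → lookup v j) (lookup∘tabulate _ i)) (lookup∘tabulate _ j)

  ent-⊗ : ∀ {n} (A B : Mat p n) i j → ent (A ⊗ₘ B) i j ≡ ∑ n (λ k → ent A i k * ent B k j)
  ent-⊗ {n} A B i j = trans (ent-mkMat _ i j)
    (trans (∑-foldr n _) (∑-cong n (λ k → sym (*-def _ _))))

  ent-Id : ∀ n i j → ent (Id p n) i j ≡ δ i j
  ent-Id n = ent-mkMat δ

  ⊗-assoc : ∀ {n} (A B C : Mat p n) → (A ⊗ₘ B) ⊗ₘ C ≡ A ⊗ₘ (B ⊗ₘ C)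
  ⊗-assoc {n} A B C = Mat-ext λ i j → begin
    ent ((A ⊗ₘ B) ⊗ₘ C) i j
      ≡⟨ ent-⊗ (A ⊗ₘ B) C i j ⟩
    ∑ n (λ k → ent (A ⊗ₘ B) i k * ent C k j)
      ≡⟨ ∑-cong n (λ k → trans (cong (_* ent C k j) (ent-⊗ A B i k)) (∑-*ʳ n (ent C k j) _)) ⟩
    ∑ n (λ k → ∑ n (λ l → ent A i l * ent B l k * ent C k j))
      ≡⟨ ∑-swap n n _ ⟩
    ∑ n (λ l → ∑ n (λ k → ent A i l * ent B l k * ent C k j))
      ≡⟨ ∑-cong n (λ l → ∑-cong n (λ k → *-assoc (ent A i l) (ent B l k) (ent C k j))) ⟩
    ∑ n (λ l → ∑ n (λ k → ent A i l * (ent B l k * ent C k j)))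
      ≡⟨ ∑-cong n (λ l → trans (cong (ent A i l *_) (ent-⊗ B C l j)) (∑-*ˡ n (ent A i l) _)) ⟨
    ∑ n (λ l → ent A i l * ent (B ⊗ₘ C) l j)
      ≡⟨ ent-⊗ A (B ⊗ₘ C) i j ⟨
    ent (A ⊗ₘ (B ⊗ₘ C)) i j ∎
    where open ≡-Reasoning

  ⊗-identityˡ : ∀ {n} (A : Mat p n) → Id p n ⊗ₘ A ≡ A
  ⊗-identityˡ {n} A = Mat-ext λ i j → trans (ent-⊗ (Id p n) A i j)
    (trans (∑-cong n (λ k → cong (_* ent A k j) (ent-Id n i k))) (∑-δˡ n i (λ k → ent A k j)))

  ⊗-identityʳ : ∀ {n} (A : Mat p n) → A ⊗ₘ Id p n ≡ A
  ⊗-identityʳ {n} A = Mat-ext λ i j → trans (ent-⊗ A (Id p n) i j)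
    (trans (∑-cong n (λ k → cong (ent A i k *_) (ent-Id n k j))) (∑-δʳ n j (ent A i)))

  module Conjugation {n} (Q Q' : Mat p n)
                     (QQ'≡I : Q ⊗ₘ Q' ≡ Id p n) (Q'Q≡I : Q' ⊗ₘ Q ≡ Id p n) where

    conj : Mat p n → Mat p n
    conj A = (Q ⊗ₘ A) ⊗ₘ Q'

    conj-Id : conj (Id p n) ≡ Id p n
    conj-Id = trans (cong (_⊗ₘ Q') (⊗-identityʳ Q)) QQ'≡I

    conj-⊗ : ∀ A B → conj (A ⊗ₘ B) ≡ conj A ⊗ₘ conj B
    conj-⊗ A B = begin
      (Q ⊗ₘ (A ⊗ₘ B)) ⊗ₘ Q'                  ≡⟨ cong (_⊗ₘ Q') (⊗-assoc Q A B) ⟨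
      (QA ⊗ₘ B) ⊗ₘ Q'                        ≡⟨ cong (λ X → (QA ⊗ₘ X) ⊗ₘ Q') (⊗-identityˡ B) ⟨
      (QA ⊗ₘ (Id p n ⊗ₘ B)) ⊗ₘ Q'            ≡⟨ cong (λ X → (QA ⊗ₘ (X ⊗ₘ B)) ⊗ₘ Q') Q'Q≡I ⟨
      (QA ⊗ₘ (Q'Q ⊗ₘ B)) ⊗ₘ Q'               ≡⟨ cong (λ X → (QA ⊗ₘ X) ⊗ₘ Q') (⊗-assoc Q' Q B) ⟩
      (QA ⊗ₘ (Q' ⊗ₘ (Q ⊗ₘ B))) ⊗ₘ Q'         ≡⟨ cong (_⊗ₘ Q') (⊗-assoc QA Q' (Q ⊗ₘ B)) ⟨
      ((QA ⊗ₘ Q') ⊗ₘ (Q ⊗ₘ B)) ⊗ₘ Q'         ≡⟨ ⊗-assoc (conj A) (Q ⊗ₘ B) Q' ⟩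
      conj A ⊗ₘ conj B                        ∎
      where
      open ≡-Reasoning
      QA = Q ⊗ₘ A
      Q'Q = Q' ⊗ₘ Q

    unconj : ∀ A → (Q' ⊗ₘ conj A) ⊗ₘ Q ≡ A
    unconj A = begin
      (Q' ⊗ₘ ((Q ⊗ₘ A) ⊗ₘ Q')) ⊗ₘ Q   ≡⟨ cong (_⊗ₘ Q) (⊗-assoc Q' (Q ⊗ₘ A) Q') ⟨
      ((Q' ⊗ₘ (Q ⊗ₘ A)) ⊗ₘ Q') ⊗ₘ Q   ≡⟨ ⊗-assoc (Q' ⊗ₘ (Q ⊗ₘ A)) Q' Q ⟩
      (Q' ⊗ₘ (Q ⊗ₘ A)) ⊗ₘ (Q' ⊗ₘ Q)   ≡⟨ cong₂ _⊗ₘ_ (sym (⊗-assoc Q' Q A)) Q'Q≡I ⟩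
      ((Q' ⊗ₘ Q) ⊗ₘ A) ⊗ₘ Id p n      ≡⟨ ⊗-identityʳ _ ⟩
      (Q' ⊗ₘ Q) ⊗ₘ A                  ≡⟨ cong (_⊗ₘ A) Q'Q≡I ⟩
      Id p n ⊗ₘ A                     ≡⟨ ⊗-identityˡ A ⟩
      A                               ∎
      where open ≡-Reasoning

    conj-injective : ∀ {A B} → conj A ≡ conj B → A ≡ B
    conj-injective {A} {B} e =
      trans (sym (unconj A)) (trans (cong (λ X → (Q' ⊗ₘ X) ⊗ₘ Q) e) (unconj B))

  -- Block structure of the index set of Mat p (N p): N p = p + 1 + p splits
  -- into a top block of size p, the middle index p, and a bottom block.

  data Pos : Set where
    top : Fin p → Pos
    mid : Pos
    bot : Fin p → Pos

  N≡p+1+p : p ℕ.+ suc p ≡ N p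
  N≡p+1+p = p+1+p≡2p+1 p

  ⌞_⌟ : Pos → Fin (N p)
  ⌞ top i ⌟ = cast N≡p+1+p (i ↑ˡ suc p)
  ⌞ mid ⌟   = cast N≡p+1+p (p ↑ʳ zero)
  ⌞ bot i ⌟ = cast N≡p+1+p (p ↑ʳ suc i)

  fromSplit : Fin p ⊎ Fin (suc p) → Pos
  fromSplit (inj₁ i)       = top i
  fromSplit (inj₂ zero)    = mid
  fromSplit (inj₂ (suc i)) = bot i

  pos : Fin (N p) → Pos
  pos k = fromSplit (splitAt p (cast (sym N≡p+1+p) k))

  pos-⌞⌟ : ∀ x → pos ⌞ x ⌟ ≡ x
  pos-⌞⌟ (top i) = trans (cong (fromSplit ∘ splitAt p) (cast-involutive (sym N≡p+1+p) N≡p+1+p _))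
                         (cong fromSplit (splitAt-↑ˡ p i (suc p)))
  pos-⌞⌟ mid     = trans (cong (fromSplit ∘ splitAt p) (cast-involutive (sym N≡p+1+p) N≡p+1+p _))
                         (cong fromSplit (splitAt-↑ʳ p (suc p) zero))
  pos-⌞⌟ (bot i) = trans (cong (fromSplit ∘ splitAt p) (cast-involutive (sym N≡p+1+p) N≡p+1+p _))
                         (cong fromSplit (splitAt-↑ʳ p (suc p) (suc i)))

  ⌞pos⌟ : ∀ k → ⌞ pos k ⌟ ≡ k
  ⌞pos⌟ k = trans (from-split (splitAt p k') refl) (cast-involutive N≡p+1+p (sym N≡p+1+p) k)
    where
    k' = cast (sym N≡p+1+p) k
    from-split : ∀ s → splitAt p k' ≡ s → ⌞ fromSplit s ⌟ ≡ cast N≡p+1+p k'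
    from-split (inj₁ i)       e = cong (cast N≡p+1+p) (splitAt⁻¹-↑ˡ e)
    from-split (inj₂ zero)    e = cong (cast N≡p+1+p) (splitAt⁻¹-↑ʳ e)
    from-split (inj₂ (suc i)) e = cong (cast N≡p+1+p) (splitAt⁻¹-↑ʳ e)

  toℕ⌞_⌟ : Pos → ℕ
  toℕ⌞ top i ⌟ = toℕ i
  toℕ⌞ mid ⌟   = p
  toℕ⌞ bot i ⌟ = suc (p ℕ.+ toℕ i)

  toℕ-⌞⌟ : ∀ x → toℕ ⌞ x ⌟ ≡ toℕ⌞ x ⌟
  toℕ-⌞⌟ (top i) = trans (toℕ-cast N≡p+1+p _) (toℕ-↑ˡ i (suc p))
  toℕ-⌞⌟ mid     = trans (toℕ-cast N≡p+1+p _) (trans (toℕ-↑ʳ p zero) (ℕ.+-identityʳ p))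
  toℕ-⌞⌟ (bot i) = trans (toℕ-cast N≡p+1+p _) (trans (toℕ-↑ʳ p (suc i)) (ℕ.+-suc p (toℕ i)))

  ∑-blocks : ∀ (f : Fin (N p) → Fp p) →
    ∑ (N p) f ≡ ∑ p (λ i → f ⌞ top i ⌟) + (f ⌞ mid ⌟ + ∑ p (λ i → f ⌞ bot i ⌟))
  ∑-blocks f = trans (∑-cast N≡p+1+p f) (∑-split p (suc p) (f ∘ cast N≡p+1+p))

  BMat : Set
  BMat = Pos → Pos → Fp p

  infix 4 _≈_
  _≈_ : BMat → BMat → Set
  A ≈ C = ∀ x y → A x y ≡ C x y

  infixl 7 _⊙_
  _⊙_ : BMat → BMat → BMat
  (A ⊙ C) x y = ∑ p (λ k → A x (top k) * C (top k) y)
              + (A x mid * C mid y + ∑ p (λ k → A x (bot k) * C (bot k) y))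

  ⊙-cong : ∀ {A A' C C'} → A ≈ A' → C ≈ C' → A ⊙ C ≈ A' ⊙ C'
  ⊙-cong e f x y =
    cong₂ _+_ (∑-cong p (λ k → cong₂ _*_ (e x (top k)) (f (top k) y)))
              (cong₂ _+_ (cong₂ _*_ (e x mid) (f mid y))
                         (∑-cong p (λ k → cong₂ _*_ (e x (bot k)) (f (bot k) y))))

  toMat : BMat → Mat p (N p)
  toMat A = mkMat (λ k l → A (pos k) (pos l))

  ent-toMat : ∀ A x y → ent (toMat A) ⌞ x ⌟ ⌞ y ⌟ ≡ A x y
  ent-toMat A x y = trans (ent-mkMat _ ⌞ x ⌟ ⌞ y ⌟) (cong₂ A (pos-⌞⌟ x) (pos-⌞⌟ y))

  Mat-ext-Pos : ∀ {X Y : Mat p (N p)} →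
    (∀ x y → ent X ⌞ x ⌟ ⌞ y ⌟ ≡ ent Y ⌞ x ⌟ ⌞ y ⌟) → X ≡ Y
  Mat-ext-Pos {X} {Y} e = Mat-ext λ k l →
    subst₂ (λ k' l' → ent X k' l' ≡ ent Y k' l') (⌞pos⌟ k) (⌞pos⌟ l) (e (pos k) (pos l))

  toMat-cong : ∀ {A C} → A ≈ C → toMat A ≡ toMat C
  toMat-cong {A} {C} e = Mat-ext-Pos λ x y →
    trans (ent-toMat A x y) (trans (e x y) (sym (ent-toMat C x y)))

  toMat-injective : ∀ {A C} → toMat A ≡ toMat C → A ≈ C
  toMat-injective {A} {C} e x y =
    trans (sym (ent-toMat A x y)) (trans (cong (λ Z → ent Z ⌞ x ⌟ ⌞ y ⌟) e) (ent-toMat C x y))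

  toMat-⊗ : ∀ A C → toMat A ⊗ₘ toMat C ≡ toMat (A ⊙ C)
  toMat-⊗ A C = Mat-ext-Pos blockwise
    where
    blockwise : ∀ x y → ent (toMat A ⊗ₘ toMat C) ⌞ x ⌟ ⌞ y ⌟ ≡ ent (toMat (A ⊙ C)) ⌞ x ⌟ ⌞ y ⌟
    blockwise x y = begin
      ent (toMat A ⊗ₘ toMat C) ⌞ x ⌟ ⌞ y ⌟
        ≡⟨ ent-⊗ (toMat A) (toMat C) ⌞ x ⌟ ⌞ y ⌟ ⟩
      ∑ (N p) (λ k → ent (toMat A) ⌞ x ⌟ k * ent (toMat C) k ⌞ y ⌟)
        ≡⟨ ∑-blocks _ ⟩
      _ ≡⟨ cong₂ _+_ (∑-cong p (λ k → entries (top k)))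
                     (cong₂ _+_ (entries mid) (∑-cong p (λ k → entries (bot k)))) ⟩
      (A ⊙ C) x y
        ≡⟨ ent-toMat (A ⊙ C) x y ⟨
      ent (toMat (A ⊙ C)) ⌞ x ⌟ ⌞ y ⌟ ∎
      where
      open ≡-Reasoning
      entries : ∀ z → ent (toMat A) ⌞ x ⌟ ⌞ z ⌟ * ent (toMat C) ⌞ z ⌟ ⌞ y ⌟ ≡ A x z * C z y
      entries z = cong₂ _*_ (ent-toMat A x z) (ent-toMat C z y)

  diagB : (Fin p → Fin p → Fp p) → (Fin p → Fin p → Fp p) → BMat
  diagB X Y (top i) (top j) = X i j
  diagB X Y mid     mid     = 1#
  diagB X Y (bot i) (bot j) = Y i j
  diagB X Y _       _       = 0#

  Ib : BMat
  Ib = diagB δ δ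

  Id≡toMat-Ib : Id p (N p) ≡ toMat Ib
  Id≡toMat-Ib = Mat-ext-Pos λ x y →
    trans (ent-Id (N p) ⌞ x ⌟ ⌞ y ⌟)
      (trans (cong₂ δℕ (toℕ-⌞⌟ x) (toℕ-⌞⌟ y)) (trans (blocks x y) (sym (ent-toMat Ib x y))))
    where
    blocks : ∀ x y → δℕ toℕ⌞ x ⌟ toℕ⌞ y ⌟ ≡ Ib x y
    blocks (top i) (top j) = refl
    blocks (top i) mid     = δℕ-≢ (ℕ.<⇒≢ (toℕ<n i))
    blocks (top i) (bot j) = δℕ-≢ (ℕ.<⇒≢ (ℕ.<-trans (toℕ<n i) (ℕ.m≤m+n (suc p) (toℕ j))))
    blocks mid     (top j) = δℕ-≢ (ℕ.>⇒≢ (toℕ<n j))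
    blocks mid     mid     = δℕ-refl p
    blocks mid     (bot j) = δℕ-≢ (ℕ.<⇒≢ (ℕ.m≤m+n (suc p) (toℕ j)))
    blocks (bot i) (top j) = δℕ-≢ (ℕ.>⇒≢ (ℕ.<-trans (toℕ<n j) (ℕ.m≤m+n (suc p) (toℕ i))))
    blocks (bot i) mid     = δℕ-≢ (ℕ.>⇒≢ (ℕ.m≤m+n (suc p) (toℕ i)))
    blocks (bot i) (bot j) = δℕ-+ (suc p) (toℕ i) (toℕ j)

  _·ₚ_ : (Fin p → Fin p → Fp p) → (Fin p → Fin p → Fp p) → Fin p → Fin p → Fp p
  (X ·ₚ Y) i j = ∑ p (λ k → X i k * Y k j)

  ∑-*0 : ∀ (f : Fin p → Fp p) → ∑ p (λ k → f k * 0#) ≡ 0#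
  ∑-*0 f = ∑-zero p (zeroʳ ∘ f)

  ∑-0* : ∀ (f : Fin p → Fp p) → ∑ p (λ k → 0# * f k) ≡ 0#
  ∑-0* f = ∑-zero p (zeroˡ ∘ f)

  zero-row : ∀ a (f : Fin p → Fp p) → 0# * a + ∑ p (λ k → 0# * f k) ≡ 0#
  zero-row a f = trans (cong₂ _+_ (zeroˡ a) (∑-0* f)) (+-identityˡ 0#)

  zero-column : ∀ a (f : Fin p → Fp p) → a * 0# + ∑ p (λ k → f k * 0#) ≡ 0#
  zero-column a f = trans (cong₂ _+_ (zeroʳ a) (∑-*0 f)) (+-identityˡ 0#)

  diag⊙-top : ∀ X Y A i y → (diagB X Y ⊙ A) (top i) y ≡ ∑ p (λ k → X i k * A (top k) y)
  diag⊙-top X Y A i y = +-zero-by _ (zero-row (A mid y) (λ k → A (bot k) y))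

  diag⊙-mid : ∀ X Y A y → (diagB X Y ⊙ A) mid y ≡ A mid y
  diag⊙-mid X Y A y = trans (zero-+ _ (∑-0* _)) (trans (+-zero-by _ (∑-0* _)) (*-identityˡ _))

  diag⊙-bot : ∀ X Y A i y → (diagB X Y ⊙ A) (bot i) y ≡ ∑ p (λ k → Y i k * A (bot k) y)
  diag⊙-bot X Y A i y = trans (zero-+ _ (∑-0* _)) (zero-+ _ (zeroˡ _))

  ⊙diag-top : ∀ X Y A x j → (A ⊙ diagB X Y) x (top j) ≡ ∑ p (λ k → A x (top k) * X k j)
  ⊙diag-top X Y A x j = +-zero-by _ (zero-column (A x mid) (λ k → A x (bot k)))

  ⊙diag-mid : ∀ X Y A x → (A ⊙ diagB X Y) x mid ≡ A x mid
  ⊙diag-mid X Y A x = trans (zero-+ _ (∑-*0 _)) (trans (+-zero-by _ (∑-*0 _)) (*-identityʳ _))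

  ⊙diag-bot : ∀ X Y A x j → (A ⊙ diagB X Y) x (bot j) ≡ ∑ p (λ k → A x (bot k) * Y k j)
  ⊙diag-bot X Y A x j = trans (zero-+ _ (∑-*0 _)) (zero-+ _ (zeroʳ _))

  diag⊙diag : ∀ X Y X' Y' → diagB X Y ⊙ diagB X' Y' ≈ diagB (X ·ₚ X') (Y ·ₚ Y')
  diag⊙diag X Y X' Y' (top i) (top j) = diag⊙-top X Y (diagB X' Y') i (top j)
  diag⊙diag X Y X' Y' (top i) mid     = trans (diag⊙-top X Y (diagB X' Y') i mid) (∑-*0 (X i))
  diag⊙diag X Y X' Y' (top i) (bot j) = trans (diag⊙-top X Y (diagB X' Y') i (bot j)) (∑-*0 (X i))
  diag⊙diag X Y X' Y' mid     y       = trans (diag⊙-mid X Y (diagB X' Y') y) (mid-row y)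
    where
    mid-row : ∀ y → diagB X' Y' mid y ≡ diagB (X ·ₚ X') (Y ·ₚ Y') mid y
    mid-row (top j) = refl
    mid-row mid     = refl
    mid-row (bot j) = refl
  diag⊙diag X Y X' Y' (bot i) (top j) = trans (diag⊙-bot X Y (diagB X' Y') i (top j)) (∑-*0 (Y i))
  diag⊙diag X Y X' Y' (bot i) mid     = trans (diag⊙-bot X Y (diagB X' Y') i mid) (∑-*0 (Y i))
  diag⊙diag X Y X' Y' (bot i) (bot j) = diag⊙-bot X Y (diagB X' Y') i (bot j)

  diagB-cong : ∀ {X Y X' Y'} → (∀ i j → X i j ≡ X' i j) → (∀ i j → Y i j ≡ Y' i j) →
               diagB X Y ≈ diagB X' Y'
  diagB-cong e f (top i) (top j) = e i j
  diagB-cong e f (top i) mid     = refl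
  diagB-cong e f (top i) (bot j) = refl
  diagB-cong e f mid     (top j) = refl
  diagB-cong e f mid     mid     = refl
  diagB-cong e f mid     (bot j) = refl
  diagB-cong e f (bot i) (top j) = refl
  diagB-cong e f (bot i) mid     = refl
  diagB-cong e f (bot i) (bot j) = f i j

  sgn : ℕ → Fp p
  sgn zero    = 1#
  sgn (suc m) = - sgn m

  sgn-+ : ∀ a b → sgn (a ℕ.+ b) ≡ sgn a * sgn b
  sgn-+ zero    b = sym (*-identityˡ (sgn b))
  sgn-+ (suc a) b = trans (cong -_ (sgn-+ a b)) (-‿distribˡ-* (sgn a) (sgn b))

  sgn-double : ∀ a → sgn (a ℕ.+ a) ≡ 1#
  sgn-double a = trans (sgn-+ a a) (square a)
    where
    square : ∀ a → sgn a * sgn a ≡ 1#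
    square zero    = *-identityˡ 1#
    square (suc a) = begin
      - sgn a * - sgn a     ≡⟨ -‿distribˡ-* (sgn a) (- sgn a) ⟨
      - (sgn a * - sgn a)   ≡⟨ cong -_ (-‿distribʳ-* (sgn a) (sgn a)) ⟨
      - - (sgn a * sgn a)   ≡⟨ -‿involutive _ ⟩
      sgn a * sgn a         ≡⟨ square a ⟩
      1#                    ∎
      where open ≡-Reasoning

  sgn-suc-suc : ∀ m n → sgn (suc m ℕ.+ suc n) ≡ sgn (m ℕ.+ n)
  sgn-suc-suc m n = trans (cong (-_ ∘ sgn) (ℕ.+-suc m n)) (-‿involutive (sgn (m ℕ.+ n)))

  -- Pascal's rule in the form C(n+1, m) = C(n, m) + C(n, m-1).
  choose-pred : ℕ → ℕ → ℕ
  choose-pred n zero    = 0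
  choose-pred n (suc m) = n choose m

  pascal : ∀ n m → [ suc n choose m ] ≡ [ n choose m ] + [ choose-pred n m ]
  pascal n zero    = sym (+-identityʳ 1#)
  pascal n (suc m) = trans ([]-+ (n choose m) (n choose suc m)) (+-comm [ n choose m ] _)

  inversion-sum : ℕ → ℕ → ℕ → Fp p
  inversion-sum B n j = ∑ℕ B (λ m → sgn (m ℕ.+ n) * ([ n choose m ] * [ m choose j ]))

  -- Terms with m > n vanish, so the range may be enlarged.
  inversion-sum-extend : ∀ B n j → n < B → inversion-sum (suc B) n j ≡ inversion-sum B n j
  inversion-sum-extend B n j n<B = begin
    inversion-sum (suc B) n j
      ≡⟨ ∑ℕ-snoc B _ ⟩
    inversion-sum B n j + sgn (B ℕ.+ n) * ([ n choose B ] * [ B choose j ])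
      ≡⟨ cong (λ z → inversion-sum B n j + sgn (B ℕ.+ n) * ([ z ] * [ B choose j ])) (choose-< n<B) ⟩
    inversion-sum B n j + sgn (B ℕ.+ n) * (0# * [ B choose j ])
      ≡⟨ cong (inversion-sum B n j +_) (trans (cong (sgn (B ℕ.+ n) *_) (zeroˡ _)) (zeroʳ _)) ⟩
    inversion-sum B n j + 0#
      ≡⟨ +-identityʳ _ ⟩
    inversion-sum B n j ∎
    where open ≡-Reasoning

  -- Splitting C(n+1, m) by Pascal's rule.
  inversion-sum-suc : ∀ B n j → n < B →
    inversion-sum (suc B) (suc n) j
      ≡ - inversion-sum B n j + ∑ℕ B (λ m → sgn (m ℕ.+ n) * ([ n choose m ] * [ suc m choose j ]))
  inversion-sum-suc B n j n<B = begin
    inversion-sum (suc B) (suc n) j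
      ≡⟨ ∑ℕ-cong (suc B) (λ m _ → split m) ⟩
    ∑ℕ (suc B) (λ m → old m + new m)
      ≡⟨ ∑ℕ-+ (suc B) old new ⟩
    ∑ℕ (suc B) old + ∑ℕ (suc B) new
      ≡⟨ cong₂ _+_ old-sum new-sum ⟩
    - inversion-sum B n j + ∑ℕ B (λ m → sgn (m ℕ.+ n) * ([ n choose m ] * [ suc m choose j ])) ∎
    where
    open ≡-Reasoning
    old new : ℕ → Fp p
    old m = sgn (m ℕ.+ suc n) * ([ n choose m ] * [ m choose j ])
    new m = sgn (m ℕ.+ suc n) * ([ choose-pred n m ] * [ m choose j ])

    split : ∀ m → sgn (m ℕ.+ suc n) * ([ suc n choose m ] * [ m choose j ]) ≡ old m + new m
    split m = trans (cong (λ z → sgn (m ℕ.+ suc n) * (z * [ m choose j ])) (pascal n m))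
                (trans (cong (sgn (m ℕ.+ suc n) *_) (distribʳ _ _ _)) (*-distribˡ-+ _ _ _))

    -- The C(n,m) part is minus the sum for n, since the sign flips.
    term : ℕ → Fp p
    term m = sgn (m ℕ.+ n) * ([ n choose m ] * [ m choose j ])
    flip : ∀ m → old m ≡ - term m
    flip m = trans (cong (λ z → sgn z * ([ n choose m ] * [ m choose j ])) (ℕ.+-suc m n))
                   (sym (-‿distribˡ-* (sgn (m ℕ.+ n)) _))
    old-sum : ∑ℕ (suc B) old ≡ - inversion-sum B n j
    old-sum = begin
      ∑ℕ (suc B) old
        ≡⟨ ∑ℕ-cong (suc B) (λ m _ → flip m) ⟩
      ∑ℕ (suc B) (λ m → - term m)
        ≡⟨ ∑ℕ-neg (suc B) term ⟩
      - inversion-sum (suc B) n j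
        ≡⟨ cong -_ (inversion-sum-extend B n j n<B) ⟩
      - inversion-sum B n j ∎

    -- The C(n,m-1) part is, after the shift m ↦ m+1, the sum with C(m+1,j).
    new-sum : ∑ℕ (suc B) new ≡ ∑ℕ B (λ m → sgn (m ℕ.+ n) * ([ n choose m ] * [ suc m choose j ]))
    new-sum = begin
      new 0 + ∑ℕ B (new ∘ suc)
        ≡⟨ cong (_+ ∑ℕ B (new ∘ suc)) (trans (cong (sgn (suc n) *_) (zeroˡ _)) (zeroʳ _)) ⟩
      0# + ∑ℕ B (new ∘ suc)
        ≡⟨ +-identityˡ _ ⟩
      ∑ℕ B (new ∘ suc)
        ≡⟨ ∑ℕ-cong B (λ m _ → cong (_* ([ n choose m ] * [ suc m choose j ])) (sgn-suc-suc m n)) ⟩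
      ∑ℕ B (λ m → sgn (m ℕ.+ n) * ([ n choose m ] * [ suc m choose j ])) ∎

  binomial-inversion : ∀ B n j → n < B → inversion-sum B n j ≡ δℕ n j
  binomial-inversion (suc B) zero j _ = begin
    1# * (1# * [ zero choose j ]) + ∑ℕ B (λ m → sgn (suc m ℕ.+ 0) * (0# * [ suc m choose j ]))
      ≡⟨ cong₂ _+_ (trans (*-identityˡ _) (*-identityˡ _))
                   (∑ℕ-zero B (λ m _ → trans (cong (sgn (suc m ℕ.+ 0) *_) (zeroˡ _)) (zeroʳ _))) ⟩
    [ zero choose j ] + 0#
      ≡⟨ +-identityʳ _ ⟩
    [ zero choose j ]
      ≡⟨ choose-zero j ⟩
    δℕ 0 j ∎
    where
    open ≡-Reasoning
    choose-zero : ∀ j → [ zero choose j ] ≡ δℕ 0 j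
    choose-zero zero    = refl
    choose-zero (suc j) = refl
  binomial-inversion (suc B) (suc n) zero (s≤s n<B) =
    trans (inversion-sum-suc B n 0 n<B) (-‿inverseˡ (inversion-sum B n 0))
  binomial-inversion (suc B) (suc n) (suc j) (s≤s n<B) = begin
    inversion-sum (suc B) (suc n) (suc j)
      ≡⟨ inversion-sum-suc B n (suc j) n<B ⟩
    - F (suc j) + ∑ℕ B (λ m → sgn (m ℕ.+ n) * ([ n choose m ] * [ suc m choose suc j ]))
      ≡⟨ cong (- F (suc j) +_) (trans (∑ℕ-cong B (λ m _ → pascal-term m)) (∑ℕ-+ B _ _)) ⟩
    - F (suc j) + (F j + F (suc j))
      ≡⟨ x∙yz≈y∙xz (- F (suc j)) (F j) (F (suc j)) ⟩
    F j + (- F (suc j) + F (suc j))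
      ≡⟨ cong (F j +_) (-‿inverseˡ _) ⟩
    F j + 0#
      ≡⟨ +-identityʳ _ ⟩
    F j
      ≡⟨ binomial-inversion B n j n<B ⟩
    δℕ n j ∎
    where
    open ≡-Reasoning
    F : ℕ → Fp p
    F = inversion-sum B n
    pascal-term : ∀ m → sgn (m ℕ.+ n) * ([ n choose m ] * [ suc m choose suc j ])
      ≡ sgn (m ℕ.+ n) * ([ n choose m ] * [ m choose j ]) + sgn (m ℕ.+ n) * ([ n choose m ] * [ m choose suc j ])
    pascal-term m = trans (cong (λ z → sgn (m ℕ.+ n) * ([ n choose m ] * z)) ([]-+ (m choose j) _))
      (trans (cong (sgn (m ℕ.+ n) *_) (*-distribˡ-+ _ _ _)) (*-distribˡ-+ _ _ _))

  -- The same identity with the sign (-1)^(m+j), using (-1)^(m+j) = (-1)^(m+n) (-1)^(n+j).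
  binomial-inversion′ : ∀ B n j → n < B →
    ∑ℕ B (λ m → sgn (m ℕ.+ j) * ([ n choose m ] * [ m choose j ])) ≡ δℕ n j
  binomial-inversion′ B n j n<B = begin
    ∑ℕ B (λ m → sgn (m ℕ.+ j) * ([ n choose m ] * [ m choose j ]))
      ≡⟨ ∑ℕ-cong B (λ m _ → regroup m) ⟩
    ∑ℕ B (λ m → sgn (n ℕ.+ j) * (sgn (m ℕ.+ n) * ([ n choose m ] * [ m choose j ])))
      ≡⟨ ∑ℕ-*ˡ B (sgn (n ℕ.+ j)) _ ⟨
    sgn (n ℕ.+ j) * inversion-sum B n j
      ≡⟨ cong (sgn (n ℕ.+ j) *_) (binomial-inversion B n j n<B) ⟩
    sgn (n ℕ.+ j) * δℕ n j
      ≡⟨ sign-on-diagonal n j ⟩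
    δℕ n j ∎
    where
    open ≡-Reasoning
    sgn-split : ∀ m → sgn (m ℕ.+ j) ≡ sgn (m ℕ.+ n) * sgn (n ℕ.+ j)
    sgn-split m = begin
      sgn (m ℕ.+ j)                              ≡⟨ *-identityʳ _ ⟨
      sgn (m ℕ.+ j) * 1#                         ≡⟨ cong (sgn (m ℕ.+ j) *_) (sgn-double n) ⟨
      sgn (m ℕ.+ j) * sgn (n ℕ.+ n)              ≡⟨ sgn-+ (m ℕ.+ j) (n ℕ.+ n) ⟨
      sgn ((m ℕ.+ j) ℕ.+ (n ℕ.+ n))              ≡⟨ cong sgn (regroup-ℕ m n j) ⟩
      sgn ((m ℕ.+ n) ℕ.+ (n ℕ.+ j))              ≡⟨ sgn-+ (m ℕ.+ n) (n ℕ.+ j) ⟩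
      sgn (m ℕ.+ n) * sgn (n ℕ.+ j)              ∎
    regroup : ∀ m → sgn (m ℕ.+ j) * ([ n choose m ] * [ m choose j ])
                  ≡ sgn (n ℕ.+ j) * (sgn (m ℕ.+ n) * ([ n choose m ] * [ m choose j ]))
    regroup m = trans (cong (_* ([ n choose m ] * [ m choose j ])) (trans (sgn-split m) (*-comm _ _)))
                      (*-assoc _ _ _)
    sign-on-diagonal : ∀ n j → sgn (n ℕ.+ j) * δℕ n j ≡ δℕ n j
    sign-on-diagonal n j with n ℕ.≟ j
    ... | yes refl = trans (cong₂ _*_ (sgn-double n) (δℕ-refl n)) (trans (*-identityˡ 1#) (sym (δℕ-refl n)))
    ... | no n≢j   = trans (cong (sgn (n ℕ.+ j) *_) (δℕ-≢ n≢j)) (trans (zeroʳ _) (sym (δℕ-≢ n≢j)))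

  rev : Fin p → ℕ
  rev i = p ∸ suc (toℕ i)

  rev<p : ∀ i → rev i < p
  rev<p i = ℕ.∸-monoʳ-< {p} {suc (toℕ i)} {0} (s≤s z≤n) (toℕ<n i)

  δℕ-rev : ∀ i j → δℕ (rev i) (rev j) ≡ δ i j
  δℕ-rev i j with i Fin.≟ j
  ... | yes refl = trans (δℕ-refl (rev i)) (sym (δ-refl i))
  ... | no i≢j   = trans (δℕ-≢ (i≢j ∘ rev-injective)) (sym (δ-≢ i≢j))
    where
    rev-injective : ∀ {i j} → rev i ≡ rev j → i ≡ j
    rev-injective e = toℕ-injective (ℕ.suc-injective (ℕ.∸-cancelˡ-≡ (toℕ<n _) (toℕ<n _) e))

  Bin Bin⁻¹ : Fin p → Fin p → Fp p
  Bin i g = [ toℕ g choose rev i ]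
  Bin⁻¹ g i = sgn (toℕ g ℕ.+ rev i) * [ rev i choose toℕ g ]

  -- Both products reduce to binomial inversion, the second after reversing
  -- the order of summation.
  Bin·Bin⁻¹ : ∀ i i' → (Bin ·ₚ Bin⁻¹) i i' ≡ δ i i'
  Bin·Bin⁻¹ i i' = begin
    ∑ p (λ g → Bin i g * Bin⁻¹ g i')
      ≡⟨ ∑-cong p (λ g → trans (*-comm (Bin i g) _) (*-assoc _ _ _)) ⟩
    ∑ p (λ g → sgn (toℕ g ℕ.+ rev i') * ([ rev i' choose toℕ g ] * Bin i g))
      ≡⟨ ∑-toℕ p (λ m → sgn (m ℕ.+ rev i') * ([ rev i' choose m ] * [ m choose rev i ])) ⟩
    inversion-sum p (rev i') (rev i)
      ≡⟨ binomial-inversion p (rev i') (rev i) (rev<p i') ⟩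
    δℕ (rev i') (rev i)
      ≡⟨ trans (δℕ-sym (rev i') (rev i)) (δℕ-rev i i') ⟩
    δ i i' ∎
    where open ≡-Reasoning

  Bin⁻¹·Bin : ∀ g g' → (Bin⁻¹ ·ₚ Bin) g g' ≡ δ g g'
  Bin⁻¹·Bin g g' = begin
    ∑ p (λ i → Bin⁻¹ g i * Bin i g')
      ≡⟨ ∑-cong p (λ i → *-assoc _ _ _) ⟩
    ∑ p (λ i → f (rev i))
      ≡⟨ ∑-toℕ p (λ m → f (p ∸ suc m)) ⟩
    ∑ℕ p (λ m → f (p ∸ suc m))
      ≡⟨ ∑ℕ-reverse p f ⟩
    ∑ℕ p f
      ≡⟨ ∑ℕ-cong p (λ m _ → cong₂ _*_ (cong sgn (ℕ.+-comm (toℕ g) m)) (*-comm _ _)) ⟩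
    ∑ℕ p (λ m → sgn (m ℕ.+ toℕ g) * ([ toℕ g' choose m ] * [ m choose toℕ g ]))
      ≡⟨ binomial-inversion′ p (toℕ g') (toℕ g) (toℕ<n g') ⟩
    δℕ (toℕ g') (toℕ g)
      ≡⟨ δ-sym g' g ⟩
    δ g g' ∎
    where
    open ≡-Reasoning
    f : ℕ → Fp p
    f m = sgn (toℕ g ℕ.+ m) * ([ m choose toℕ g ] * [ toℕ g' choose m ])

  infixl 9 _!_
  _!_ : ∀ {A : Set} {n} → Vec A n → Fin n → A
  _!_ = lookup

  infixl 6 _+ᵣ_ _+ₘ_
  infixr 7 _▷ᵣ_ _▷ₘ_ _⊗ᵣ_
  _+ᵣ_ : R p → R p → R p
  _+ᵣ_ = _+R_ p

  _▷ᵣ_ : U2 p → R p → R p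
  _▷ᵣ_ = _▷R_ p

  _+ₘ_ : M p → M p → M p
  _+ₘ_ = _+M_ p

  _▷ₘ_ : G̃ p → M p → M p
  _▷ₘ_ = _▷M_ p

  _⊗ᵣ_ : R p → R p → M p
  _⊗ᵣ_ = _⊠_ p

  ⟪_,_,_,_,_⟫ : M p → R p → U2 p → R p → U2 p → Ũ₅ p
  ⟪ u , x₁ , h₁ , x₂ , h₂ ⟫ = u , ((x₁ , h₁) , (x₂ , h₂))

  !-+R : ∀ (r s : R p) g → (r +ᵣ s) ! g ≡ r ! g + s ! g
  !-+R r s g = trans (lookup∘tabulate _ g) (sym (+-def _ _))

  !-▷R : ∀ h (r : R p) g → (h ▷ᵣ r) ! g ≡ r ! (g - h)
  !-▷R h r g = trans (lookup∘tabulate _ g) (cong (r !_) (sym (-‿def g h)))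

  !-+M : ∀ (m n : M p) g g' → (m +ₘ n) ! g ! g' ≡ m ! g ! g' + n ! g ! g'
  !-+M m n g g' = trans (cong (_! g') (lookup∘tabulate _ g)) (trans (lookup∘tabulate _ g') (sym (+-def _ _)))

  !-⊠ : ∀ (r s : R p) g g' → (r ⊗ᵣ s) ! g ! g' ≡ r ! g * s ! g'
  !-⊠ r s g g' = trans (cong (_! g') (lookup∘tabulate _ g)) (trans (lookup∘tabulate _ g') (sym (*-def _ _)))

  !-▷M : ∀ x₁ h₁ x₂ h₂ (m : M p) g g' →
    (((x₁ , h₁) , (x₂ , h₂)) ▷ₘ m) ! g ! g' ≡ m ! (g - h₁) ! (g' - h₂)
  !-▷M x₁ h₁ x₂ h₂ m g g' = trans (cong (_! g') (lookup∘tabulate _ g))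
    (trans (lookup∘tabulate _ g') (cong₂ (λ a b → m ! a ! b) (sym (-‿def g h₁)) (sym (-‿def g' h₂))))

  M-ext : ∀ {m m' : M p} → (∀ g g' → m ! g ! g' ≡ m' ! g ! g') → m ≡ m'
  M-ext e = vec-ext (λ g → vec-ext (e g))

  !-·u : ∀ u x₁ h₁ x₂ h₂ u' x₂' g g' →
    ((u +ₘ (((x₁ , h₁) , (x₂ , h₂)) ▷ₘ u')) +ₘ (x₁ ⊗ᵣ (h₂ ▷ᵣ x₂'))) ! g ! g'
      ≡ (u ! g ! g' + u' ! (g - h₁) ! (g' - h₂)) + x₁ ! g * x₂' ! (g' - h₂)
  !-·u u x₁ h₁ x₂ h₂ u' x₂' g g' = trans (!-+M (u +ₘ v) w g g')
    (cong₂ _+_ (trans (!-+M u v g g') (cong (u ! g ! g' +_) (!-▷M x₁ h₁ x₂ h₂ u' g g')))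
               (trans (!-⊠ x₁ (h₂ ▷ᵣ x₂') g g') (cong (x₁ ! g *_) (!-▷R h₂ x₂' g'))))
    where
    v = ((x₁ , h₁) , (x₂ , h₂)) ▷ₘ u'
    w = x₁ ⊗ᵣ (h₂ ▷ᵣ x₂')

  !-·x : ∀ x h x' g → (x +ᵣ (h ▷ᵣ x')) ! g ≡ x ! g + x' ! (g - h)
  !-·x x h x' g = trans (!-+R x (h ▷ᵣ x') g) (cong (x ! g +_) (!-▷R h x' g))

  -- The product of Ũ₅, sealed so that products are compared through the
  -- product formula below rather than by unfolding.
  infixl 7 _·_
  opaque
    _·_ : Ũ₅ p → Ũ₅ p → Ũ₅ p
    _·_ = _·Ũ_ p

    ·-def : ∀ a b → a · b ≡ _·Ũ_ p a b
    ·-def a b = refl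

    ·-formula : ∀ {u x₁ h₁ x₂ h₂ u' x₁' h₁' x₂' h₂' U X₁ H₁ X₂ H₂} →
      (∀ g g' → (u ! g ! g' + u' ! (g - h₁) ! (g' - h₂)) + x₁ ! g * x₂' ! (g' - h₂) ≡ U ! g ! g') →
      (∀ g → x₁ ! g + x₁' ! (g - h₁) ≡ X₁ ! g) → h₁ + h₁' ≡ H₁ →
      (∀ g → x₂ ! g + x₂' ! (g - h₂) ≡ X₂ ! g) → h₂ + h₂' ≡ H₂ →
      ⟪ u , x₁ , h₁ , x₂ , h₂ ⟫ · ⟪ u' , x₁' , h₁' , x₂' , h₂' ⟫
        ≡ ⟪ U , X₁ , H₁ , X₂ , H₂ ⟫
    ·-formula {u} {x₁} {h₁} {x₂} {h₂} {u'} {x₁'} {h₁'} {x₂'} {h₂'} eu ex₁ eh₁ ex₂ eh₂ =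
      cong₂ _,_ (M-ext λ g g' → trans (!-·u u x₁ h₁ x₂ h₂ u' x₂' g g') (eu g g'))
        (cong₂ _,_ (cong₂ _,_ (vec-ext λ g → trans (!-·x x₁ h₁ x₁' g) (ex₁ g))
                              (trans (sym (+-def h₁ h₁')) eh₁))
                   (cong₂ _,_ (vec-ext λ g → trans (!-·x x₂ h₂ x₂' g) (ex₂ g))
                              (trans (sym (+-def h₂ h₂')) eh₂)))

  sub-add : ∀ a h → (a - h) + h ≡ a
  sub-add a h = begin
    (a - h) + h      ≡⟨ cong (_+ h) (-‿≡+- a h) ⟩
    (a + - h) + h    ≡⟨ +-assoc a (- h) h ⟩
    a + (- h + h)    ≡⟨ cong (a +_) (-‿inverseˡ h) ⟩
    a + 0#           ≡⟨ +-identityʳ a ⟩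
    a                ∎
    where open ≡-Reasoning

  add-sub : ∀ a h → (a + h) - h ≡ a
  add-sub a h = begin
    (a + h) - h      ≡⟨ -‿≡+- (a + h) h ⟩
    (a + h) + - h    ≡⟨ +-assoc a h (- h) ⟩
    a + (h + - h)    ≡⟨ cong (a +_) (-‿inverseʳ h) ⟩
    a + 0#           ≡⟨ +-identityʳ a ⟩
    a                ∎
    where open ≡-Reasoning

  sub-0 : ∀ a → a - 0# ≡ a
  sub-0 a = trans (-‿≡+- a 0#) (trans (cong (a +_) -0#≈0#) (+-identityʳ a))

  δ-shift : ∀ i k h → δ i (k + h) ≡ δ (i - h) k
  δ-shift i k h with (i - h) Fin.≟ k
  ... | yes refl = trans (cong (δ i) (sub-add i h)) (trans (δ-refl i) (sym (δ-refl (i - h))))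
  ... | no  ne   = trans (δ-≢ (λ e → ne (trans (cong (_- h) e) (add-sub k h)))) (sym (δ-≢ ne))

  ∑-δ-shift : ∀ i h (f : Fin p → Fp p) → ∑ p (λ k → δ i (k + h) * f k) ≡ f (i - h)
  ∑-δ-shift i h f = trans (∑-cong p (λ k → cong (_* f k) (δ-shift i k h))) (∑-δˡ p (i - h) f)

  shift-+ : ∀ j h h' → j + _+F_ p h h' ≡ (j + h') + h
  shift-+ j h h' = trans (cong (j +_) (trans (sym (+-def h h')) (+-comm h h'))) (sym (+-assoc j h' h))

  shift-+-sub : ∀ j h h' → (j + _+F_ p h h') - h ≡ j + h'
  shift-+-sub j h h' = trans (cong (_- h) (shift-+ j h h')) (add-sub (j + h') h)

  -- The faithful representation ρ of Ũ₅ on F_p[U₂] ⊕ F_p ⊕ F_p[U₂]: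
  --            ⎡ P(h₁)  x₁   u P(h₂) ⎤
  --   ρ(a)  =  ⎢   0     1   x₂ P(h₂) ⎥     (P(h) = translation by h)
  --            ⎣   0     0    P(h₂)  ⎦
  -- for a = (u, (x₁,h₁), (x₂,h₂)).

  ρ : Ũ₅ p → BMat
  ρ (u , ((x₁ , h₁) , (x₂ , h₂))) (top i) (top j) = δ i (j + h₁)
  ρ (u , ((x₁ , h₁) , (x₂ , h₂))) (top i) mid     = x₁ ! i
  ρ (u , ((x₁ , h₁) , (x₂ , h₂))) (top i) (bot j) = u ! i ! (j + h₂)
  ρ (u , ((x₁ , h₁) , (x₂ , h₂))) mid     mid     = 1#
  ρ (u , ((x₁ , h₁) , (x₂ , h₂))) mid     (bot j) = x₂ ! (j + h₂)
  ρ (u , ((x₁ , h₁) , (x₂ , h₂))) (bot i) (bot j) = δ i (j + h₂)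
  ρ _                              _       _       = 0#

  ρ⊙-top : ∀ u x₁ h₁ x₂ h₂ C i y → (ρ ⟪ u , x₁ , h₁ , x₂ , h₂ ⟫ ⊙ C) (top i) y
    ≡ C (top (i - h₁)) y + (x₁ ! i * C mid y + ∑ p (λ k → u ! i ! (k + h₂) * C (bot k) y))
  ρ⊙-top u x₁ h₁ x₂ h₂ C i y =
    cong (_+ (x₁ ! i * C mid y + ∑ p (λ k → u ! i ! (k + h₂) * C (bot k) y)))
         (∑-δ-shift i h₁ (λ k → C (top k) y))

  ρ⊙-mid : ∀ u x₁ h₁ x₂ h₂ C y → (ρ ⟪ u , x₁ , h₁ , x₂ , h₂ ⟫ ⊙ C) mid y
    ≡ C mid y + ∑ p (λ k → x₂ ! (k + h₂) * C (bot k) y)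
  ρ⊙-mid u x₁ h₁ x₂ h₂ C y =
    trans (zero-+ _ (∑-0* _)) (cong (_+ ∑ p (λ k → x₂ ! (k + h₂) * C (bot k) y)) (*-identityˡ _))

  ρ⊙-bot : ∀ u x₁ h₁ x₂ h₂ C i y →
    (ρ ⟪ u , x₁ , h₁ , x₂ , h₂ ⟫ ⊙ C) (bot i) y ≡ C (bot (i - h₂)) y
  ρ⊙-bot u x₁ h₁ x₂ h₂ C i y = begin
    ∑ p (λ k → 0# * C (top k) y) + (0# * C mid y + ∑ p (λ k → δ i (k + h₂) * C (bot k) y))
      ≡⟨ cong₂ _+_ (∑-0* _) (cong₂ _+_ (zeroˡ _) (∑-δ-shift i h₂ (λ k → C (bot k) y))) ⟩
    0# + (0# + C (bot (i - h₂)) y)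
      ≡⟨ trans (+-identityˡ _) (+-identityˡ _) ⟩
    C (bot (i - h₂)) y ∎
    where open ≡-Reasoning

  -- Translation blocks multiply like the translations: P(h) P(h') = P(h + h').
  δ-shift-shift : ∀ i j h h' → δ (i - h) (j + h') ≡ δ i (j + _+F_ p h h')
  δ-shift-shift i j h h' = trans (sym (δ-shift i (j + h') h)) (cong (δ i) (sym (shift-+ j h h')))

  ρ-hom : ∀ a b → ρ a ⊙ ρ b ≈ ρ (_·Ũ_ p a b)
  ρ-hom (u , ((x₁ , h₁) , (x₂ , h₂))) b@(u' , ((x₁' , h₁') , (x₂' , h₂'))) = blocks
    where
    open ≡-Reasoning
    J : Fin p → Fin p
    J j = j + _+F_ p h₂ h₂'
    ρa⊙ρb = ρ ⟪ u , x₁ , h₁ , x₂ , h₂ ⟫ ⊙ ρ b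
    blocks : ∀ x y → ρa⊙ρb x y ≡ ρ (_·Ũ_ p ⟪ u , x₁ , h₁ , x₂ , h₂ ⟫ b) x y
    blocks (top i) (top j) = begin
      ρa⊙ρb (top i) (top j)
        ≡⟨ ρ⊙-top u x₁ h₁ x₂ h₂ (ρ b) i (top j) ⟩
      δ (i - h₁) (j + h₁') + (x₁ ! i * 0# + ∑ p (λ k → u ! i ! (k + h₂) * 0#))
        ≡⟨ +-zero-by _ (zero-column (x₁ ! i) _) ⟩
      δ (i - h₁) (j + h₁')
        ≡⟨ δ-shift-shift i j h₁ h₁' ⟩
      δ i (j + _+F_ p h₁ h₁') ∎
    blocks (top i) mid = begin
      ρa⊙ρb (top i) mid
        ≡⟨ ρ⊙-top u x₁ h₁ x₂ h₂ (ρ b) i mid ⟩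
      x₁' ! (i - h₁) + (x₁ ! i * 1# + ∑ p (λ k → u ! i ! (k + h₂) * 0#))
        ≡⟨ cong (x₁' ! (i - h₁) +_) (trans (cong₂ _+_ (*-identityʳ _) (∑-*0 _)) (+-identityʳ _)) ⟩
      x₁' ! (i - h₁) + x₁ ! i
        ≡⟨ +-comm _ _ ⟩
      x₁ ! i + x₁' ! (i - h₁)
        ≡⟨ !-·x x₁ h₁ x₁' i ⟨
      (x₁ +ᵣ (h₁ ▷ᵣ x₁')) ! i ∎
    blocks (top i) (bot j) = begin
      ρa⊙ρb (top i) (bot j)
        ≡⟨ ρ⊙-top u x₁ h₁ x₂ h₂ (ρ b) i (bot j) ⟩
      u' ! (i - h₁) ! (j + h₂')
        + (x₁ ! i * x₂' ! (j + h₂') + ∑ p (λ k → u ! i ! (k + h₂) * δ k (j + h₂')))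
        ≡⟨ cong (λ z → u' ! (i - h₁) ! (j + h₂') + (x₁ ! i * x₂' ! (j + h₂') + z))
                (∑-δʳ p (j + h₂') (λ k → u ! i ! (k + h₂))) ⟩
      u' ! (i - h₁) ! (j + h₂') + (x₁ ! i * x₂' ! (j + h₂') + u ! i ! ((j + h₂') + h₂))
        ≡⟨ x∙yz≈zx∙y _ _ _ ⟩
      (u ! i ! ((j + h₂') + h₂) + u' ! (i - h₁) ! (j + h₂')) + x₁ ! i * x₂' ! (j + h₂')
        ≡⟨ cong₂ (λ a c → (u ! i ! a + u' ! (i - h₁) ! c) + x₁ ! i * x₂' ! c)
                 (sym (shift-+ j h₂ h₂')) (sym (shift-+-sub j h₂ h₂')) ⟩
      (u ! i ! J j + u' ! (i - h₁) ! (J j - h₂)) + x₁ ! i * x₂' ! (J j - h₂)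
        ≡⟨ !-·u u x₁ h₁ x₂ h₂ u' x₂' i (J j) ⟨
      ρ (_·Ũ_ p ⟪ u , x₁ , h₁ , x₂ , h₂ ⟫ b) (top i) (bot j) ∎
    blocks mid (top j) = trans (ρ⊙-mid u x₁ h₁ x₂ h₂ (ρ b) (top j)) (trans (+-identityˡ _) (∑-*0 _))
    blocks mid mid     = trans (ρ⊙-mid u x₁ h₁ x₂ h₂ (ρ b) mid) (+-zero-by 1# (∑-*0 _))
    blocks mid (bot j) = begin
      ρa⊙ρb mid (bot j)
        ≡⟨ ρ⊙-mid u x₁ h₁ x₂ h₂ (ρ b) (bot j) ⟩
      x₂' ! (j + h₂') + ∑ p (λ k → x₂ ! (k + h₂) * δ k (j + h₂'))
        ≡⟨ cong (x₂' ! (j + h₂') +_) (∑-δʳ p (j + h₂') (λ k → x₂ ! (k + h₂))) ⟩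
      x₂' ! (j + h₂') + x₂ ! ((j + h₂') + h₂)
        ≡⟨ +-comm _ _ ⟩
      x₂ ! ((j + h₂') + h₂) + x₂' ! (j + h₂')
        ≡⟨ cong₂ (λ a c → x₂ ! a + x₂' ! c) (sym (shift-+ j h₂ h₂')) (sym (shift-+-sub j h₂ h₂')) ⟩
      x₂ ! J j + x₂' ! (J j - h₂)
        ≡⟨ !-·x x₂ h₂ x₂' (J j) ⟨
      (x₂ +ᵣ (h₂ ▷ᵣ x₂')) ! J j ∎
    blocks (bot i) (top j) = ρ⊙-bot u x₁ h₁ x₂ h₂ (ρ b) i (top j)
    blocks (bot i) mid     = ρ⊙-bot u x₁ h₁ x₂ h₂ (ρ b) i mid
    blocks (bot i) (bot j) = trans (ρ⊙-bot u x₁ h₁ x₂ h₂ (ρ b) i (bot j)) (δ-shift-shift i j h₂ h₂')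

  -- ρ is faithful (for p > 1, where 1 ≠ 0 in F_p).
  1#≢0# : 1 < p → 1# ≢ 0#
  1#≢0# 1<p e = ℕ.0≢1+n (sym (trans (sym (trans (toℕ[] 1) (m<n⇒m%n≡m 1<p))) (trans (cong toℕ e) toℕ-0#)))

  δ≡1⇒≡ : 1 < p → ∀ {a b : Fin p} → δ a b ≡ 1# → a ≡ b
  δ≡1⇒≡ 1<p {a} {b} e with a Fin.≟ b
  ... | yes a≡b = a≡b
  ... | no  a≢b = ⊥-elim (1#≢0# 1<p (trans (sym e) (δ-≢ a≢b)))

  ρ-injective : 1 < p → ∀ a b → ρ a ≈ ρ b → a ≡ b
  ρ-injective 1<p (u , ((x₁ , h₁) , (x₂ , h₂))) (u' , ((x₁' , h₁') , (x₂' , h₂'))) e =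
    components (translation-part (e (top h₁) (top 0#))) (translation-part (e (bot h₂) (bot 0#)))
    where
    -- The translation part is read off from the column of the index 0.
    translation-part : ∀ {h h'} → δ h (0# + h) ≡ δ h (0# + h') → h ≡ h'
    translation-part {h} {h'} e' = δ≡1⇒≡ 1<p (begin
      δ h h'          ≡⟨ cong (δ h) (+-identityˡ h') ⟨
      δ h (0# + h')   ≡⟨ e' ⟨
      δ h (0# + h)    ≡⟨ cong (δ h) (+-identityˡ h) ⟩
      δ h h           ≡⟨ δ-refl h ⟩
      1#              ∎)
      where open ≡-Reasoning
    -- The other components are read off from the blocks, untranslating by h₂.
    components : h₁ ≡ h₁' → h₂ ≡ h₂' →
      ⟪ u , x₁ , h₁ , x₂ , h₂ ⟫ ≡ ⟪ u' , x₁' , h₁' , x₂' , h₂' ⟫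
    components refl refl = cong₂ _,_
      (M-ext λ i g → subst (λ z → u ! i ! z ≡ u' ! i ! z) (sub-add g h₂) (e (top i) (bot (g - h₂))))
      (cong₂ _,_ (cong (_, h₁) (vec-ext λ i → e (top i) mid))
                 (cong (_, h₂) (vec-ext λ g →
                   subst (λ z → x₂ ! z ≡ x₂' ! z) (sub-add g h₂) (e mid (bot (g - h₂))))))

  ≈-sym : ∀ {A C} → A ≈ C → C ≈ A
  ≈-sym e x y = sym (e x y)

  ≈-trans : ∀ {A C D} → A ≈ C → C ≈ D → A ≈ D
  ≈-trans e f x y = trans (e x y) (f x y)

  Qb Qb⁻¹ : BMat
  Qb   = diagB Bin Bin
  Qb⁻¹ = diagB Bin⁻¹ Bin⁻¹

  diag-inverse : ∀ {X X'} → (∀ i j → (X ·ₚ X') i j ≡ δ i j) →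
    toMat (diagB X X) ⊗ₘ toMat (diagB X' X') ≡ Id p (N p)
  diag-inverse {X} {X'} XX'≡I = begin
    toMat (diagB X X) ⊗ₘ toMat (diagB X' X')   ≡⟨ toMat-⊗ (diagB X X) (diagB X' X') ⟩
    toMat (diagB X X ⊙ diagB X' X')            ≡⟨ toMat-cong (≈-trans (diag⊙diag X X X' X')
                                                                      (diagB-cong XX'≡I XX'≡I)) ⟩
    toMat Ib                                   ≡⟨ Id≡toMat-Ib ⟨
    Id p (N p)                                 ∎
    where open ≡-Reasoning

  open Conjugation (toMat Qb) (toMat Qb⁻¹) (diag-inverse Bin·Bin⁻¹) (diag-inverse Bin⁻¹·Bin) public

  -- Sealed, so that equations between matrices φ a are never unfolded.
  opaque
    φ : Ũ₅ p → Mat p (N p)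
    φ a = conj (toMat (ρ a))

    φ-def : ∀ a → φ a ≡ conj (toMat (ρ a))
    φ-def a = refl

  φ-hom : ∀ a b → φ (_·Ũ_ p a b) ≡ φ a ⊗ₘ φ b
  φ-hom a b = begin
    φ (_·Ũ_ p a b)                     ≡⟨ φ-def (_·Ũ_ p a b) ⟩
    conj (toMat (ρ (_·Ũ_ p a b)))      ≡⟨ cong conj (toMat-cong (ρ-hom a b)) ⟨
    conj (toMat (ρ a ⊙ ρ b))           ≡⟨ cong conj (toMat-⊗ (ρ a) (ρ b)) ⟨
    conj (toMat (ρ a) ⊗ₘ toMat (ρ b))  ≡⟨ conj-⊗ (toMat (ρ a)) (toMat (ρ b)) ⟩
    conj (toMat (ρ a)) ⊗ₘ conj (toMat (ρ b)) ≡⟨ cong₂ _⊗ₘ_ (φ-def a) (φ-def b) ⟨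
    φ a ⊗ₘ φ b                         ∎
    where open ≡-Reasoning

  φ-injective : 1 < p → ∀ a b → φ a ≡ φ b → a ≡ b
  φ-injective 1<p a b φa≡φb =
    ρ-injective 1<p a b (toMat-injective (conj-injective (trans (sym (φ-def a)) (trans φa≡φb (φ-def b)))))

  0R : R p
  0R = tabulate (λ _ → 0#)

  0M : M p
  0M = tabulate (λ _ → 0R)

  !-0R : ∀ g → 0R ! g ≡ 0#
  !-0R = lookup∘tabulate (λ _ → 0#)

  !-0M : ∀ g g' → 0M ! g ! g' ≡ 0#
  !-0M g g' = trans (cong (_! g') (lookup∘tabulate (λ _ → 0R) g)) (!-0R g')

  e : Ũ₅ p
  e = ⟪ 0M , 0R , 0# , 0R , 0# ⟫

  ρ-e : ρ e ≈ Ib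
  ρ-e (top i) (top j) = cong (δ i) (+-identityʳ j)
  ρ-e (top i) mid     = !-0R i
  ρ-e (top i) (bot j) = !-0M i (j + 0#)
  ρ-e mid     (top j) = refl
  ρ-e mid     mid     = refl
  ρ-e mid     (bot j) = !-0R (j + 0#)
  ρ-e (bot i) (top j) = refl
  ρ-e (bot i) mid     = refl
  ρ-e (bot i) (bot j) = cong (δ i) (+-identityʳ j)

  φ-e : φ e ≡ Id p (N p)
  φ-e = trans (φ-def e) (trans (cong conj (trans (toMat-cong ρ-e) (sym Id≡toMat-Ib))) conj-Id)

  inverse-u : M p → R p → U2 p → R p → U2 p → M p
  inverse-u u x₁ h₁ x₂ h₂ =
    tabulate λ g → tabulate λ g' → - (u ! (g + h₁) ! (g' + h₂)) + x₁ ! (g + h₁) * x₂ ! (g' + h₂)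

  inverse-x : R p → U2 p → R p
  inverse-x x h = tabulate λ g → - (x ! (g + h))

  !-inverse-u : ∀ u x₁ h₁ x₂ h₂ g g' →
    inverse-u u x₁ h₁ x₂ h₂ ! g ! g' ≡ - (u ! (g + h₁) ! (g' + h₂)) + x₁ ! (g + h₁) * x₂ ! (g' + h₂)
  !-inverse-u u x₁ h₁ x₂ h₂ g g' = trans (cong (_! g') (lookup∘tabulate _ g)) (lookup∘tabulate _ g')

  !-inverse-x : ∀ x h g → inverse-x x h ! g ≡ - (x ! (g + h))
  !-inverse-x x h g = lookup∘tabulate _ g

  _⁻¹ : Ũ₅ p → Ũ₅ p
  (u , ((x₁ , h₁) , (x₂ , h₂))) ⁻¹ =
    ⟪ inverse-u u x₁ h₁ x₂ h₂ , inverse-x x₁ h₁ , - h₁ , inverse-x x₂ h₂ , - h₂ ⟫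

  sub-neg : ∀ g h → g - (- h) ≡ g + h
  sub-neg g h = trans (-‿≡+- g (- h)) (cong (g +_) (-‿involutive h))

  ⁻¹-inverseˡ : ∀ a → a ⁻¹ · a ≡ e
  ⁻¹-inverseˡ (u , ((x₁ , h₁) , (x₂ , h₂))) =
    ·-formula (λ g g' → trans (u-part g g') (sym (!-0M g g')))
              (λ g → trans (x-part x₁ h₁ g) (sym (!-0R g))) (-‿inverseˡ h₁)
              (λ g → trans (x-part x₂ h₂ g) (sym (!-0R g))) (-‿inverseˡ h₂)
    where
    open ≡-Reasoning
    cancel : ∀ U X Y → ((- U + X * Y) + U) + (- X) * Y ≡ 0#
    cancel U X Y = begin
      ((- U + X * Y) + U) + (- X) * Y   ≡⟨ cong₂ _+_ (xy∙z≈xz∙y (- U) (X * Y) U)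
                                                     (sym (-‿distribˡ-* X Y)) ⟩
      ((- U + U) + X * Y) + - (X * Y)   ≡⟨ cong (λ z → (z + X * Y) + - (X * Y)) (-‿inverseˡ U) ⟩
      (0# + X * Y) + - (X * Y)          ≡⟨ cong (_+ - (X * Y)) (+-identityˡ (X * Y)) ⟩
      X * Y + - (X * Y)                 ≡⟨ -‿inverseʳ (X * Y) ⟩
      0#                                ∎
    u-part : ∀ g g' → (inverse-u u x₁ h₁ x₂ h₂ ! g ! g' + u ! (g - - h₁) ! (g' - - h₂))
                       + inverse-x x₁ h₁ ! g * x₂ ! (g' - - h₂) ≡ 0#
    u-part g g' = begin
      (u⁻ ! g ! g' + u ! (g - - h₁) ! (g' - - h₂)) + x₁⁻ ! g * x₂ ! (g' - - h₂)
        ≡⟨ cong₂ (λ a b → (u⁻ ! g ! g' + u ! a ! b) + x₁⁻ ! g * x₂ ! b)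
                 (sub-neg g h₁) (sub-neg g' h₂) ⟩
      (u⁻ ! g ! g' + U) + x₁⁻ ! g * Y
        ≡⟨ cong₂ (λ a b → (a + U) + b * Y) (!-inverse-u u x₁ h₁ x₂ h₂ g g') (!-inverse-x x₁ h₁ g) ⟩
      ((- U + X * Y) + U) + (- X) * Y
        ≡⟨ cancel U X Y ⟩
      0# ∎
      where
      u⁻ = inverse-u u x₁ h₁ x₂ h₂
      x₁⁻ = inverse-x x₁ h₁
      U = u ! (g + h₁) ! (g' + h₂)
      X = x₁ ! (g + h₁)
      Y = x₂ ! (g' + h₂)
    x-part : ∀ x h g → inverse-x x h ! g + x ! (g - - h) ≡ 0#
    x-part x h g = trans (cong₂ _+_ (!-inverse-x x h g) (cong (x !_) (sub-neg g h))) (-‿inverseˡ _)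

  𝟙 : Bool → Fp p
  𝟙 b = if b then 1# else 0#

  𝟙-true : ∀ {b} → T b → 𝟙 b ≡ 1#
  𝟙-true {true} _ = refl

  𝟙-false : ∀ {b} → ¬ T b → 𝟙 b ≡ 0#
  𝟙-false {true}  ¬b = ⊥-elim (¬b _)
  𝟙-false {false} _  = refl

  unitSupℕ : (ℕ → Bool) → ℕ → ℕ → Fp p
  unitSupℕ S m n = if m ≡ᵇ n then 1# else (if (n ≡ᵇ suc m) ∧ S m then 1# else 0#)

  unitSupℕ-δ : ∀ S m n → unitSupℕ S m n ≡ δℕ m n + δℕ n (suc m) * 𝟙 (S m)
  unitSupℕ-δ S m n with m ≡ᵇ n in m≡ᵇn
  ... | true  = sym (trans (cong (1# +_) (trans (cong (_* 𝟙 (S m)) (δℕ-≢ n≢1+m)) (zeroˡ _))) (+-identityʳ 1#))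
    where
    n≢1+m : n ≢ suc m
    n≢1+m n≡1+m = ℕ.1+n≢n (sym (trans (ℕ.≡ᵇ⇒≡ m n (subst T (sym m≡ᵇn) _)) n≡1+m))
  ... | false with n ≡ᵇ suc m | S m
  ...   | true  | true  = sym (trans (+-identityˡ _) (*-identityˡ 1#))
  ...   | true  | false = sym (trans (+-identityˡ _) (zeroʳ 1#))
  ...   | false | true  = sym (trans (+-identityˡ _) (zeroˡ 1#))
  ...   | false | false = sym (trans (+-identityˡ _) (zeroˡ 0#))

  unitSupB : (ℕ → Bool) → BMat
  unitSupB S (top i) (top j) = δ i j + δℕ (toℕ j) (suc (toℕ i)) * 𝟙 (S (toℕ i))
  unitSupB S (top i) mid     = δℕ p (suc (toℕ i)) * 𝟙 (S (toℕ i))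
  unitSupB S mid     mid     = 1#
  unitSupB S mid     (bot j) = δℕ (toℕ j) 0 * 𝟙 (S p)
  unitSupB S (bot i) (bot j) = δ i j + δℕ (toℕ j) (suc (toℕ i)) * 𝟙 (S (suc (p ℕ.+ toℕ i)))
  unitSupB S _       _       = 0#

  unitSup≡toMat : ∀ S → unitSup p (N p) S ≡ toMat (unitSupB S)
  unitSup≡toMat S = Mat-ext-Pos λ x y → begin
    ent (unitSup p (N p) S) ⌞ x ⌟ ⌞ y ⌟       ≡⟨ ent-mkMat (unitSupℕ S on toℕ) ⌞ x ⌟ ⌞ y ⌟ ⟩
    unitSupℕ S (toℕ ⌞ x ⌟) (toℕ ⌞ y ⌟)       ≡⟨ unitSupℕ-δ S _ _ ⟩
    unitSupδ (toℕ ⌞ x ⌟) (toℕ ⌞ y ⌟)         ≡⟨ cong₂ unitSupδ (toℕ-⌞⌟ x) (toℕ-⌞⌟ y) ⟩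
    unitSupδ toℕ⌞ x ⌟ toℕ⌞ y ⌟               ≡⟨ blocks x y ⟩
    unitSupB S x y                           ≡⟨ ent-toMat (unitSupB S) x y ⟨
    ent (toMat (unitSupB S)) ⌞ x ⌟ ⌞ y ⌟     ∎
    where
    open ≡-Reasoning
    unitSupδ : ℕ → ℕ → Fp p
    unitSupδ m n = δℕ m n + δℕ n (suc m) * 𝟙 (S m)
    both-zero : ∀ {m n} → m ≢ n → n ≢ suc m → unitSupδ m n ≡ 0#
    both-zero {m} m≢n n≢1+m =
      trans (cong₂ _+_ (δℕ-≢ m≢n) (trans (cong (_* 𝟙 (S m)) (δℕ-≢ n≢1+m)) (zeroˡ _))) (+-identityˡ 0#)
    i<p = toℕ<n
    p<bot : ∀ i → p < suc (p ℕ.+ i)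
    p<bot i = ℕ.m≤m+n (suc p) i
    p<bot+1 : ∀ i → p < suc (suc (p ℕ.+ i))
    p<bot+1 i = ℕ.<-trans (p<bot i) (ℕ.n<1+n _)
    blocks : ∀ x y → unitSupδ toℕ⌞ x ⌟ toℕ⌞ y ⌟ ≡ unitSupB S x y
    blocks (top i) (top j) = refl
    blocks (top i) mid     = zero-+ _ (δℕ-≢ (ℕ.<⇒≢ (i<p i)))
    blocks (top i) (bot j) = both-zero (ℕ.<⇒≢ (ℕ.<-trans (i<p i) (p<bot (toℕ j))))
                                       (ℕ.>⇒≢ (s≤s (ℕ.<-≤-trans (i<p i) (ℕ.m≤m+n p (toℕ j)))))
    blocks mid     (top j) = both-zero (ℕ.>⇒≢ (i<p j)) (ℕ.<⇒≢ (ℕ.<-trans (i<p j) (ℕ.n<1+n p)))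
    blocks mid     mid     = trans (cong (_+ δℕ p (suc p) * 𝟙 (S p)) (δℕ-refl p))
                                   (+-zero-by 1# (trans (cong (_* 𝟙 (S p)) (δℕ-≢ p≢1+p)) (zeroˡ _)))
      where
      p≢1+p = ℕ.<⇒≢ (ℕ.n<1+n p)
    blocks mid     (bot j) = trans (zero-+ _ (δℕ-≢ (ℕ.<⇒≢ (p<bot (toℕ j)))))
      (cong (_* 𝟙 (S p)) (trans (cong (δℕ (p ℕ.+ toℕ j)) (sym (ℕ.+-identityʳ p))) (δℕ-+ p (toℕ j) 0)))
    blocks (bot i) (top j) = both-zero (ℕ.>⇒≢ (ℕ.<-trans (i<p j) (p<bot (toℕ i))))
                                       (ℕ.<⇒≢ (ℕ.<-trans (i<p j) (p<bot+1 (toℕ i))))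
    blocks (bot i) mid     = both-zero (ℕ.>⇒≢ (p<bot (toℕ i))) (ℕ.<⇒≢ (p<bot+1 (toℕ i)))
    blocks (bot i) (bot j) = cong₂ _+_ (δℕ-+ p (toℕ i) (toℕ j))
      (cong (_* 𝟙 (S (suc (p ℕ.+ toℕ i))))
            (trans (cong (δℕ (p ℕ.+ toℕ j)) (sym (ℕ.+-suc p (toℕ i)))) (δℕ-+ p (toℕ j) (suc (toℕ i)))))

  unipotent : (Fin p → Fp p) → (Fin p → Fp p) → BMat
  unipotent v w (top i) (top j) = δ i j
  unipotent v w (top i) mid     = v i
  unipotent v w mid     mid     = 1#
  unipotent v w mid     (bot j) = w j
  unipotent v w (bot i) (bot j) = δ i j
  unipotent v w _       _       = 0#

  translation : Fin p → Fin p → Fin p → Fp p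
  translation h i j = δ i (j + h)

  ρ-translation : ∀ h₁ h₂ → ρ ⟪ 0M , 0R , h₁ , 0R , h₂ ⟫ ≈ diagB (translation h₁) (translation h₂)
  ρ-translation h₁ h₂ (top i) (top j) = refl
  ρ-translation h₁ h₂ (top i) mid     = !-0R i
  ρ-translation h₁ h₂ (top i) (bot j) = !-0M i (j + h₂)
  ρ-translation h₁ h₂ mid     (top j) = refl
  ρ-translation h₁ h₂ mid     mid     = refl
  ρ-translation h₁ h₂ mid     (bot j) = !-0R (j + h₂)
  ρ-translation h₁ h₂ (bot i) (top j) = refl
  ρ-translation h₁ h₂ (bot i) mid     = refl
  ρ-translation h₁ h₂ (bot i) (bot j) = refl

  ρ-unipotent : ∀ x₁ x₂ → ρ ⟪ 0M , x₁ , 0# , x₂ , 0# ⟫ ≈ unipotent (x₁ !_) (x₂ !_)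
  ρ-unipotent x₁ x₂ (top i) (top j) = cong (δ i) (+-identityʳ j)
  ρ-unipotent x₁ x₂ (top i) mid     = refl
  ρ-unipotent x₁ x₂ (top i) (bot j) = !-0M i (j + 0#)
  ρ-unipotent x₁ x₂ mid     (top j) = refl
  ρ-unipotent x₁ x₂ mid     mid     = refl
  ρ-unipotent x₁ x₂ mid     (bot j) = cong (x₂ !_) (+-identityʳ j)
  ρ-unipotent x₁ x₂ (bot i) (top j) = refl
  ρ-unipotent x₁ x₂ (bot i) mid     = refl
  ρ-unipotent x₁ x₂ (bot i) (bot j) = cong (δ i) (+-identityʳ j)

  φ-intertwine : ∀ g S → Qb ⊙ ρ g ≈ S ⊙ Qb → φ g ≡ toMat S
  φ-intertwine g S QρS = begin
    φ g                                       ≡⟨ φ-def g ⟩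
    (toMat Qb ⊗ₘ toMat (ρ g)) ⊗ₘ toMat Qb⁻¹   ≡⟨ cong (_⊗ₘ toMat Qb⁻¹) (toMat-⊗ Qb (ρ g)) ⟩
    toMat (Qb ⊙ ρ g) ⊗ₘ toMat Qb⁻¹            ≡⟨ cong (_⊗ₘ toMat Qb⁻¹) (toMat-cong QρS) ⟩
    toMat (S ⊙ Qb) ⊗ₘ toMat Qb⁻¹              ≡⟨ cong (_⊗ₘ toMat Qb⁻¹) (toMat-⊗ S Qb) ⟨
    (toMat S ⊗ₘ toMat Qb) ⊗ₘ toMat Qb⁻¹       ≡⟨ ⊗-assoc (toMat S) (toMat Qb) (toMat Qb⁻¹) ⟩
    toMat S ⊗ₘ (toMat Qb ⊗ₘ toMat Qb⁻¹)       ≡⟨ cong (toMat S ⊗ₘ_) (diag-inverse Bin·Bin⁻¹) ⟩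
    toMat S ⊗ₘ Id p (N p)                     ≡⟨ ⊗-identityʳ (toMat S) ⟩
    toMat S                                   ∎
    where open ≡-Reasoning

  φ-diagonal : ∀ g X Y X' Y' → ρ g ≈ diagB X Y →
    (∀ i j → (Bin ·ₚ X) i j ≡ (X' ·ₚ Bin) i j) → (∀ i j → (Bin ·ₚ Y) i j ≡ (Y' ·ₚ Bin) i j) →
    φ g ≡ toMat (diagB X' Y')
  φ-diagonal g X Y X' Y' ρg BX BY = φ-intertwine g (diagB X' Y')
    (≈-trans (⊙-cong {Qb} {Qb} (λ _ _ → refl) ρg)
      (≈-trans (diag⊙diag Bin Bin X Y) (≈-trans (diagB-cong BX BY) (≈-sym (diag⊙diag X' Y' Bin Bin)))))

  Bin·δ : ∀ i j → (Bin ·ₚ δ) i j ≡ (δ ·ₚ Bin) i j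
  Bin·δ i j = trans (∑-δʳ p j (Bin i)) (sym (∑-δˡ p i (λ k → Bin k j)))

  φ-unipotent : ∀ g v w v' w' → ρ g ≈ unipotent v w →
    (∀ i → ∑ p (λ k → Bin i k * v k) ≡ v' i) → (∀ j → w j ≡ ∑ p (λ k → w' k * Bin k j)) →
    φ g ≡ toMat (unipotent v' w')
  φ-unipotent g v w v' w' ρg Bv Bw = φ-intertwine g U' (≈-trans (⊙-cong {Qb} {Qb} (λ _ _ → refl) ρg) blocks)
    where
    U U' : BMat
    U  = unipotent v w
    U' = unipotent v' w'
    L  = diag⊙-top Bin Bin U
    Lm = diag⊙-mid Bin Bin U
    Lb = diag⊙-bot Bin Bin U
    Rt = ⊙diag-top Bin Bin U'
    Rm = ⊙diag-mid Bin Bin U'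
    Rb = ⊙diag-bot Bin Bin U'
    blocks : Qb ⊙ U ≈ U' ⊙ Qb
    blocks (top i) (top j) = trans (L i (top j)) (trans (Bin·δ i j) (sym (Rt (top i) j)))
    blocks (top i) mid     = trans (L i mid) (trans (Bv i) (sym (Rm (top i))))
    blocks (top i) (bot j) = trans (L i (bot j)) (trans (∑-*0 (Bin i)) (sym (trans (Rb (top i) j) (∑-0* _))))
    blocks mid     (top j) = trans (Lm (top j)) (sym (trans (Rt mid j) (∑-0* _)))
    blocks mid     mid     = trans (Lm mid) (sym (Rm mid))
    blocks mid     (bot j) = trans (Lm (bot j)) (trans (Bw j) (sym (Rb mid j)))
    blocks (bot i) (top j) = trans (Lb i (top j)) (trans (∑-*0 (Bin i)) (sym (trans (Rt (bot i) j) (∑-0* _))))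
    blocks (bot i) mid     = trans (Lb i mid) (trans (∑-*0 (Bin i)) (sym (Rm (bot i))))
    blocks (bot i) (bot j) = trans (Lb i (bot j)) (trans (Bin·δ i j) (sym (Rb (bot i) j)))

  𝟙-< : ∀ {m n} → m < n → 𝟙 (m ℕ.<ᵇ n) ≡ 1#
  𝟙-< m<n = 𝟙-true (ℕ.<⇒<ᵇ m<n)

  𝟙-≮ : ∀ {m n} → ¬ m < n → 𝟙 (m ℕ.<ᵇ n) ≡ 0#
  𝟙-≮ {m} {n} m≮n = 𝟙-false (m≮n ∘ ℕ.<ᵇ⇒< m n)

  module _ (p-prime : Prime p) where

    1<p : 1 < p
    1<p = ℕ.nonTrivial⇒n>1 p {{prime⇒nonTrivial p-prime}}

    toℕ-+1 : ∀ g → toℕ (g + 1#) ≡ suc (toℕ g) % p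
    toℕ-+1 g = begin
      toℕ (g + 1#)                ≡⟨ cong (λ z → toℕ (z + 1#)) ([toℕ] g) ⟨
      toℕ ([ toℕ g ] + [ 1 ])     ≡⟨ cong toℕ ([]-+ (toℕ g) 1) ⟨
      toℕ [ toℕ g ℕ.+ 1 ]         ≡⟨ toℕ[] _ ⟩
      (toℕ g ℕ.+ 1) % p           ≡⟨ cong (_% p) (ℕ.+-comm (toℕ g) 1) ⟩
      suc (toℕ g) % p             ∎
      where open ≡-Reasoning

    []-∣ : ∀ {m} → p ∣ m → [ m ] ≡ 0#
    []-∣ (divides q refl) = trans ([]-* q p) (trans (cong ([ q ] *_) [p]≡0) (zeroʳ _))

    -- Pascal's rule for the columns of Bin: the column of g + 1 is the
    -- column of g plus the column of g shifted one row down.  When g + 1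
    -- wraps around to 0 this uses p ∣ C(p, k) for 0 < k < p.
    Bin-shift : ∀ i g → suc (toℕ i) < p →
      Bin i (g + 1#) ≡ Bin i g + [ toℕ g choose (p ∸ suc (suc (toℕ i))) ]
    Bin-shift i g i+1<p = begin
      [ toℕ (g + 1#) choose rev i ]
        ≡⟨ cong (λ k → [ toℕ (g + 1#) choose k ]) (∸-suc-pred i+1<p) ⟩
      [ toℕ (g + 1#) choose suc a ]
        ≡⟨ wrap (suc (toℕ g) ℕ.<? p) ⟩
      [ suc (toℕ g) choose suc a ]
        ≡⟨ []-+ (toℕ g choose a) (toℕ g choose suc a) ⟩
      [ toℕ g choose a ] + [ toℕ g choose suc a ]
        ≡⟨ +-comm _ _ ⟩
      [ toℕ g choose suc a ] + [ toℕ g choose a ]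
        ≡⟨ cong (λ k → [ toℕ g choose k ] + [ toℕ g choose a ]) (∸-suc-pred i+1<p) ⟨
      Bin i g + [ toℕ g choose a ] ∎
      where
      open ≡-Reasoning
      a = p ∸ suc (suc (toℕ i))
      wrap : Dec (suc (toℕ g) < p) → [ toℕ (g + 1#) choose suc a ] ≡ [ suc (toℕ g) choose suc a ]
      wrap (yes g+1<p) = cong (λ n → [ n choose suc a ]) (trans (toℕ-+1 g) (m<n⇒m%n≡m g+1<p))
      wrap (no g+1≮p)  = begin
        [ toℕ (g + 1#) choose suc a ]   ≡⟨ cong (λ n → [ n choose suc a ]) g+1≡0 ⟩
        [ 0 choose suc a ]              ≡⟨ []-∣ p∣pCk ⟨
        [ suc (toℕ g) choose suc a ]    ∎
        where
        g+1≡p : suc (toℕ g) ≡ p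
        g+1≡p = ℕ.≤-antisym (toℕ<n g) (ℕ.≮⇒≥ g+1≮p)
        g+1≡0 : toℕ (g + 1#) ≡ 0
        g+1≡0 = trans (toℕ-+1 g) (trans (cong (_% p) g+1≡p) (n%n≡0 p))
        p∣pCk : p ∣ suc (toℕ g) choose suc a
        p∣pCk = subst (λ q → q ∣ suc (toℕ g) choose suc a) g+1≡p
          (prime∣choose (toℕ g) a (subst Prime (sym g+1≡p) p-prime)
            (subst₂ _<_ (∸-suc-pred i+1<p) (sym g+1≡p) (rev<p i)))

    -- The Jordan block with superdiagonal entries c i (only those with
    -- i + 1 < p occur), and the translation by 1.
    Jordan : (Fin p → Fp p) → Fin p → Fin p → Fp p
    Jordan c i j = δ i j + δℕ (toℕ j) (suc (toℕ i)) * c i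

    P₁ : Fin p → Fin p → Fp p
    P₁ = translation 1#

    Bin-Jordan : ∀ c → (∀ i → suc (toℕ i) < p → c i ≡ 1#) →
      ∀ i j → (Bin ·ₚ P₁) i j ≡ (Jordan c ·ₚ Bin) i j
    Bin-Jordan c c≡1 i j = sym (begin
      ∑ p (λ k → (δ i k + δℕ (toℕ k) (suc (toℕ i)) * c i) * Bin k j)
        ≡⟨ ∑-cong p (λ k → trans (distribʳ (Bin k j) (δ i k) _) (cong (δ i k * Bin k j +_) (rearrange k))) ⟩
      ∑ p (λ k → δ i k * Bin k j + c i * (δℕ (toℕ k) (suc (toℕ i)) * Bin k j))
        ≡⟨ ∑-+ p _ _ ⟩
      ∑ p (λ k → δ i k * Bin k j) + ∑ p (λ k → c i * (δℕ (toℕ k) (suc (toℕ i)) * Bin k j))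
        ≡⟨ cong₂ _+_ (∑-δˡ p i (λ k → Bin k j))
                     (trans (sym (∑-*ˡ p (c i) _)) (cong (c i *_) (∑-toℕ p next-row))) ⟩
      Bin i j + c i * ∑ℕ p next-row
        ≡⟨ next-row-sum (suc (toℕ i) ℕ.<? p) ⟩
      Bin i (j + 1#)
        ≡⟨ ∑-δʳ p (j + 1#) (Bin i) ⟨
      ∑ p (λ k → Bin i k * δ k (j + 1#)) ∎)
      where
      open ≡-Reasoning
      next-row : ℕ → Fp p
      next-row m = δℕ m (suc (toℕ i)) * [ toℕ j choose (p ∸ suc m) ]
      rearrange : ∀ k → δℕ (toℕ k) (suc (toℕ i)) * c i * Bin k j
                      ≡ c i * (δℕ (toℕ k) (suc (toℕ i)) * Bin k j)
      rearrange k = trans (cong (_* Bin k j) (*-comm _ (c i))) (*-assoc (c i) _ _)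
      -- Row i+1 of Bin is the shift in Pascal's rule; for the last row it is absent.
      next-row-sum : Dec (suc (toℕ i) < p) → Bin i j + c i * ∑ℕ p next-row ≡ Bin i (j + 1#)
      next-row-sum (yes i+1<p) = begin
        Bin i j + c i * ∑ℕ p next-row
          ≡⟨ cong (Bin i j +_) (trans (cong₂ _*_ (c≡1 i i+1<p) (∑ℕ-δ p (suc (toℕ i)) _ i+1<p))
                                      (*-identityˡ _)) ⟩
        Bin i j + [ toℕ j choose (p ∸ suc (suc (toℕ i))) ]
          ≡⟨ Bin-shift i j i+1<p ⟨
        Bin i (j + 1#) ∎
      next-row-sum (no i+1≮p) = begin
        Bin i j + c i * ∑ℕ p next-row
          ≡⟨ +-zero-by (Bin i j) (*-zero-by (c i) (∑ℕ-zero p (λ m m<p →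
               trans (cong (_* _) (δℕ-≢ (m≢i+1 m<p))) (zeroˡ _)))) ⟩
        [ toℕ j choose rev i ]
          ≡⟨ cong (λ k → [ toℕ j choose k ]) rev≡0 ⟩
        1#
          ≡⟨ cong (λ k → [ toℕ (j + 1#) choose k ]) rev≡0 ⟨
        Bin i (j + 1#) ∎
        where
        i+1≡p : suc (toℕ i) ≡ p
        i+1≡p = ℕ.≤-antisym (toℕ<n i) (ℕ.≮⇒≥ i+1≮p)
        m≢i+1 : ∀ {m} → m < p → m ≢ suc (toℕ i)
        m≢i+1 m<p e = ℕ.<⇒≢ m<p (trans e i+1≡p)
        rev≡0 : rev i ≡ 0
        rev≡0 = trans (cong (p ∸_) i+1≡p) (ℕ.n∸n≡0 p)

    δR : Fin p → R p
    δR c = tabulate (δ c)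

    last : Fin p
    last = fromℕ< {p ∸ 1} (subst (ℕ._≤ p) (sym (ℕ.suc-pred p)) ℕ.≤-refl)

    g₁ g₂ g₃ g₄ : Ũ₅ p
    g₁ = ⟪ 0M , 0R , 1# , 0R , 0# ⟫
    g₂ = ⟪ 0M , δR 0# , 0# , 0R , 0# ⟫
    g₃ = ⟪ 0M , 0R , 0# , δR last , 0# ⟫
    g₄ = ⟪ 0M , 0R , 0# , 0R , 1# ⟫

    δℕ*𝟙< : ∀ a b → δℕ a b * 𝟙 (b ℕ.<ᵇ a) ≡ 0#
    δℕ*𝟙< a b with a ℕ.≟ b
    ... | yes refl = *-zero-by (δℕ a a) (𝟙-≮ {a} {a} (ℕ.<-irrefl refl))
    ... | no  a≢b  = trans (cong (_* 𝟙 (b ℕ.<ᵇ a)) (δℕ-≢ a≢b)) (zeroˡ _)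

    σ₁'-blocks : unitSupB (λ k → suc k ℕ.<ᵇ p) ≈ diagB (Jordan (λ i → 𝟙 (suc (toℕ i) ℕ.<ᵇ p))) δ
    σ₁'-blocks (top i) (top j) = refl
    σ₁'-blocks (top i) mid     = δℕ*𝟙< p (suc (toℕ i))
    σ₁'-blocks (top i) (bot j) = refl
    σ₁'-blocks mid     (top j) = refl
    σ₁'-blocks mid     mid     = refl
    σ₁'-blocks mid     (bot j) = *-zero-by (δℕ (toℕ j) 0) (𝟙-≮ (ℕ.<-asym (ℕ.n<1+n p)))
    σ₁'-blocks (bot i) (top j) = refl
    σ₁'-blocks (bot i) mid     = refl
    σ₁'-blocks (bot i) (bot j) =
      +-zero-by (δ i j) (*-zero-by _ (𝟙-≮ λ lt → ℕ.<-asym lt (ℕ.<-trans (p<bot i) (ℕ.n<1+n _))))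
      where
      p<bot : ∀ i → p < suc (p ℕ.+ toℕ i)
      p<bot i = ℕ.m≤m+n (suc p) (toℕ i)

    σ₄'-blocks : unitSupB (λ k → suc p ℕ.≤ᵇ k)
               ≈ diagB δ (Jordan (λ i → 𝟙 (p ℕ.<ᵇ suc (p ℕ.+ toℕ i))))
    σ₄'-blocks (top i) (top j) = +-zero-by (δ i j) (*-zero-by _ (𝟙-≮ (ℕ.<-asym (toℕ<n i))))
    σ₄'-blocks (top i) mid     = *-zero-by _ (𝟙-≮ (ℕ.<-asym (toℕ<n i)))
    σ₄'-blocks (top i) (bot j) = refl
    σ₄'-blocks mid     (top j) = refl
    σ₄'-blocks mid     mid     = refl
    σ₄'-blocks mid     (bot j) = *-zero-by (δℕ (toℕ j) 0) (𝟙-≮ {p} {p} (ℕ.<-irrefl refl))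
    σ₄'-blocks (bot i) (top j) = refl
    σ₄'-blocks (bot i) mid     = refl
    σ₄'-blocks (bot i) (bot j) = refl

    σ₂'-blocks : unitSupB (λ k → suc k ℕ.≡ᵇ p) ≈ unipotent (λ i → δℕ p (suc (toℕ i))) (λ _ → 0#)
    σ₂'-blocks (top i) (top j) = +-zero-by (δ i j) (last-row (suc (toℕ i) ℕ.≟ p))
      where
      last-row : Dec (suc (toℕ i) ≡ p) → δℕ (toℕ j) (suc (toℕ i)) * δℕ (suc (toℕ i)) p ≡ 0#
      last-row (yes i+1≡p) =
        trans (cong (_* _) (trans (cong (δℕ (toℕ j)) i+1≡p) (δℕ-≢ (ℕ.<⇒≢ (toℕ<n j))))) (zeroˡ _)
      last-row (no  i+1≢p) = *-zero-by _ (δℕ-≢ i+1≢p)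
    σ₂'-blocks (top i) mid with suc (toℕ i) ℕ.≟ p
    ... | yes i+1≡p =
      trans (cong (δℕ p (suc (toℕ i)) *_) (trans (cong (λ z → δℕ z p) i+1≡p) (δℕ-refl p))) (*-identityʳ _)
    ... | no  i+1≢p = trans (*-zero-by _ (δℕ-≢ i+1≢p)) (sym (δℕ-≢ (i+1≢p ∘ sym)))
    σ₂'-blocks (top i) (bot j) = refl
    σ₂'-blocks mid     (top j) = refl
    σ₂'-blocks mid     mid     = refl
    σ₂'-blocks mid     (bot j) = *-zero-by (δℕ (toℕ j) 0) (δℕ-≢ (ℕ.<⇒≢ (ℕ.n<1+n p) ∘ sym))
    σ₂'-blocks (bot i) (top j) = refl
    σ₂'-blocks (bot i) mid     = refl
    σ₂'-blocks (bot i) (bot j) =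
      +-zero-by (δ i j) (*-zero-by _ (δℕ-≢ (ℕ.>⇒≢ (s≤s (ℕ.m≤n⇒m≤1+n (ℕ.m≤m+n p (toℕ i)))))))

    σ₃'-blocks : unitSupB (λ k → suc k ℕ.≡ᵇ suc p) ≈ unipotent (λ _ → 0#) (λ j → δℕ (toℕ j) 0)
    σ₃'-blocks (top i) (top j) = +-zero-by (δ i j) (*-zero-by _ (δℕ-≢ (ℕ.<⇒≢ (toℕ<n i))))
    σ₃'-blocks (top i) mid     = *-zero-by _ (δℕ-≢ (ℕ.<⇒≢ (toℕ<n i)))
    σ₃'-blocks (top i) (bot j) = refl
    σ₃'-blocks mid     (top j) = refl
    σ₃'-blocks mid     mid     = refl
    σ₃'-blocks mid     (bot j) = trans (cong (δℕ (toℕ j) 0 *_) (δℕ-refl p)) (*-identityʳ _)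
    σ₃'-blocks (bot i) (top j) = refl
    σ₃'-blocks (bot i) mid     = refl
    σ₃'-blocks (bot i) (bot j) =
      +-zero-by (δ i j) (*-zero-by _ (δℕ-≢ (ℕ.>⇒≢ (s≤s (ℕ.m≤m+n p (toℕ i))))))

    !-δR : ∀ c g → δR c ! g ≡ δ c g
    !-δR c = lookup∘tabulate (δ c)

    Bin·P₀ : ∀ i j → (Bin ·ₚ translation 0#) i j ≡ (δ ·ₚ Bin) i j
    Bin·P₀ i j =
      trans (∑-δʳ p (j + 0#) (Bin i)) (trans (cong (Bin i) (+-identityʳ j)) (sym (∑-δˡ p i (λ k → Bin k j))))

    φ-g₁ : φ g₁ ≡ σ₁' p
    φ-g₁ = begin
      φ g₁                          ≡⟨ φ-diagonal g₁ P₁ (translation 0#) J δ (ρ-translation 1# 0#)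
                                                  (Bin-Jordan c (λ _ → 𝟙-<)) Bin·P₀ ⟩
      toMat (diagB J δ)             ≡⟨ toMat-cong σ₁'-blocks ⟨
      toMat (unitSupB S)            ≡⟨ unitSup≡toMat S ⟨
      σ₁' p                         ∎
      where
      open ≡-Reasoning
      S = λ k → suc k ℕ.<ᵇ p
      c = λ i → 𝟙 (suc (toℕ i) ℕ.<ᵇ p)
      J = Jordan c

    φ-g₄ : φ g₄ ≡ σ₄' p
    φ-g₄ = begin
      φ g₄                          ≡⟨ φ-diagonal g₄ (translation 0#) P₁ δ J (ρ-translation 0# 1#)
                                                  Bin·P₀ (Bin-Jordan c (λ i _ → 𝟙-< (p<bot i))) ⟩
      toMat (diagB δ J)             ≡⟨ toMat-cong σ₄'-blocks ⟨
      toMat (unitSupB S)            ≡⟨ unitSup≡toMat S ⟨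
      σ₄' p                         ∎
      where
      open ≡-Reasoning
      S = λ k → suc p ℕ.≤ᵇ k
      c = λ i → 𝟙 (p ℕ.<ᵇ suc (p ℕ.+ toℕ i))
      p<bot : ∀ i → p < suc (p ℕ.+ toℕ i)
      p<bot i = ℕ.m≤m+n (suc p) (toℕ i)
      J = Jordan c

    φ-g₂ : φ g₂ ≡ σ₂' p
    φ-g₂ = begin
      φ g₂                          ≡⟨ φ-unipotent g₂ (δR 0# !_) (0R !_) v' (λ _ → 0#)
                                         (ρ-unipotent (δR 0#) 0R) Bin-column
                                         (λ j → trans (!-0R j) (sym (∑-0* (λ k → Bin k j)))) ⟩
      toMat (unipotent v' (λ _ → 0#)) ≡⟨ toMat-cong σ₂'-blocks ⟨
      toMat (unitSupB S)            ≡⟨ unitSup≡toMat S ⟨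
      σ₂' p                         ∎
      where
      open ≡-Reasoning
      S = λ k → suc k ℕ.≡ᵇ p
      v' = λ i → δℕ p (suc (toℕ i))
      -- The column of 0 in Bin is C(0, p-1-i) = δ(i, p-1).
      Bin-column : ∀ i → ∑ p (λ k → Bin i k * δR 0# ! k) ≡ v' i
      Bin-column i = begin
        ∑ p (λ k → Bin i k * δR 0# ! k)     ≡⟨ ∑-cong p (λ k → cong (Bin i k *_) (δR-sym k)) ⟩
        ∑ p (λ k → Bin i k * δ k 0#)        ≡⟨ ∑-δʳ p 0# (Bin i) ⟩
        [ toℕ 0# choose rev i ]             ≡⟨ cong (λ n → [ n choose rev i ]) toℕ-0# ⟩
        [ 0 choose rev i ]                  ≡⟨ zero-choose-rev (rev i) refl ⟩
        v' i                                ∎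
        where
        δR-sym : ∀ k → δR 0# ! k ≡ δ k 0#
        δR-sym k = trans (!-δR 0# k) (δ-sym 0# k)
        zero-choose-rev : ∀ m → rev i ≡ m → [ 0 choose m ] ≡ v' i
        zero-choose-rev zero    e =
          sym (trans (cong (δℕ p) (ℕ.≤-antisym (toℕ<n i) (ℕ.m∸n≡0⇒m≤n e))) (δℕ-refl p))
        zero-choose-rev (suc m) e = sym (δℕ-≢ {p} {suc (toℕ i)} λ p≡i+1 →
          ℕ.0≢1+n (trans (sym (trans (cong (p ∸_) (sym p≡i+1)) (ℕ.n∸n≡0 p))) e))

    φ-g₃ : φ g₃ ≡ σ₃' p
    φ-g₃ = begin
      φ g₃                          ≡⟨ φ-unipotent g₃ (0R !_) (δR last !_) (λ _ → 0#) w'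
                                         (ρ-unipotent 0R (δR last))
                                         (λ i → ∑-zero p (λ k → *-zero-by (Bin i k) (!-0R k))) Bin-row ⟩
      toMat (unipotent (λ _ → 0#) w') ≡⟨ toMat-cong σ₃'-blocks ⟨
      toMat (unitSupB S)            ≡⟨ unitSup≡toMat S ⟨
      σ₃' p                         ∎
      where
      open ≡-Reasoning
      S = λ k → suc k ℕ.≡ᵇ suc p
      w' = λ j → δℕ (toℕ j) 0
      toℕ-last : toℕ last ≡ p ∸ 1
      toℕ-last = toℕ-fromℕ< _
      -- The row of 0 in Bin is C(g, p-1) = δ(g, p-1).
      Bin-row : ∀ j → δR last ! j ≡ ∑ p (λ k → w' k * Bin k j)
      Bin-row j = begin
        δR last ! j
          ≡⟨ trans (!-δR last j) (cong (λ n → δℕ n (toℕ j)) toℕ-last) ⟩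
        δℕ (p ∸ 1) (toℕ j)
          ≡⟨ last-column (toℕ j ℕ.≟ p ∸ 1) ⟩
        [ toℕ j choose (p ∸ 1) ]
          ≡⟨ ∑ℕ-δ p 0 (λ m → [ toℕ j choose (p ∸ suc m) ]) (ℕ.>-nonZero⁻¹ p) ⟨
        ∑ℕ p (λ m → δℕ m 0 * [ toℕ j choose (p ∸ suc m) ])
          ≡⟨ ∑-toℕ p _ ⟨
        ∑ p (λ k → w' k * Bin k j) ∎
        where
        last-column : Dec (toℕ j ≡ p ∸ 1) → δℕ (p ∸ 1) (toℕ j) ≡ [ toℕ j choose (p ∸ 1) ]
        j≤p-1 : toℕ j ℕ.≤ p ∸ 1
        j≤p-1 = ℕ.≤-pred (subst (suc (toℕ j) ℕ.≤_) (sym (ℕ.suc-pred p)) (toℕ<n j))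
        last-column (yes j≡p-1) = trans (cong (δℕ (p ∸ 1)) j≡p-1) (trans (δℕ-refl (p ∸ 1))
          (sym (trans (cong (λ n → [ n choose (p ∸ 1) ]) j≡p-1) (cong [_] (choose-self (p ∸ 1))))))
        last-column (no  j≢p-1) =
          trans (δℕ-≢ (j≢p-1 ∘ sym)) (sym (cong [_] (choose-< (ℕ.≤∧≢⇒< j≤p-1 j≢p-1))))

    left≡right-inverse : ∀ {n} {A' A B : Mat p n} → A' ⊗ₘ A ≡ Id p n → A ⊗ₘ B ≡ Id p n → A' ≡ B
    left≡right-inverse {n} {A'} {A} {B} A'A≡I AB≡I = begin
      A'                    ≡⟨ ⊗-identityʳ A' ⟨
      A' ⊗ₘ Id p n          ≡⟨ cong (A' ⊗ₘ_) AB≡I ⟨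
      A' ⊗ₘ (A ⊗ₘ B)        ≡⟨ ⊗-assoc A' A B ⟨
      (A' ⊗ₘ A) ⊗ₘ B        ≡⟨ cong (_⊗ₘ B) A'A≡I ⟩
      Id p n ⊗ₘ B           ≡⟨ ⊗-identityˡ B ⟩
      B                     ∎
      where open ≡-Reasoning

    φ-⁻¹ : ∀ a → φ (a ⁻¹) ⊗ₘ φ a ≡ Id p (N p)
    φ-⁻¹ a = begin
      φ (a ⁻¹) ⊗ₘ φ a         ≡⟨ φ-hom (a ⁻¹) a ⟨
      φ (_·Ũ_ p (a ⁻¹) a)     ≡⟨ cong φ (·-def (a ⁻¹) a) ⟨
      φ (a ⁻¹ · a)            ≡⟨ cong φ (⁻¹-inverseˡ a) ⟩
      φ e                     ≡⟨ φ-e ⟩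
      Id p (N p)              ∎
      where open ≡-Reasoning

    Gen⇒image : ∀ {X} → Gen p X → ∃ λ a → φ a ≡ X
    Gen⇒image (gen zero)                   = g₁ , φ-g₁
    Gen⇒image (gen (suc zero))             = g₂ , φ-g₂
    Gen⇒image (gen (suc (suc zero)))       = g₃ , φ-g₃
    Gen⇒image (gen (suc (suc (suc zero)))) = g₄ , φ-g₄
    Gen⇒image one                          = e , φ-e
    Gen⇒image (mul GA GB) with Gen⇒image GA | Gen⇒image GB
    ... | a , refl | b , refl = _·Ũ_ p a b , φ-hom a b
    Gen⇒image (inv GA AB≡I) with Gen⇒image GA
    ... | a , refl = a ⁻¹ , left≡right-inverse {A = φ a} (φ-⁻¹ a) AB≡I

    InGen : Ũ₅ p → Set
    InGen a = Gen p (φ a)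

    InGen-· : ∀ {a b} → InGen a → InGen b → InGen (a · b)
    InGen-· {a} {b} Ga Gb = subst (Gen p) (sym (trans (cong φ (·-def a b)) (φ-hom a b))) (mul Ga Gb)

    InGen-e : InGen e
    InGen-e = subst (Gen p) (sym φ-e) one

    cyclic : (H : Fp p → Ũ₅ p) → H 0# ≡ e → (∀ h h' → H h · H h' ≡ H (h + h')) →
             InGen (H 1#) → ∀ h → InGen (H h)
    cyclic H H0≡e H-hom H1 = []-elim multiples
      where
      multiples : ∀ n → InGen (H [ n ])
      multiples zero    = subst InGen (sym H0≡e) InGen-e
      multiples (suc n) = subst InGen (trans (H-hom [ n ] 1#) (cong H [suc])) (InGen-· (multiples n) H1)
        where
        [suc] : [ n ] + 1# ≡ [ suc n ]
        [suc] = sym (trans (cong [_] (ℕ.+-comm 1 n)) ([]-+ n 1))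

    module SpanR = Span 0# (_+F_ p) (λ a → trans (sym (+-def 0# a)) (+-identityˡ a))
                                     (λ a → trans (sym (+-def a 0#)) (+-identityʳ a))

    single-0 : ∀ c → SpanR.single c 0# ≡ 0R
    single-0 c = vec-ext λ g → trans (lookup∘tabulate _ g) (trans (both-0 (toℕ c ≡ᵇ toℕ g)) (sym (!-0R g)))
      where
      both-0 : ∀ b → (if b then 0# else 0#) ≡ 0#
      both-0 true  = refl
      both-0 false = refl

    single-+ : ∀ c a a' → SpanR.single c (a + a') ≡ SpanR.single c a +ᵣ SpanR.single c a'
    single-+ c a a' = vec-ext λ g → trans (lookup∘tabulate _ g)
      (sym (trans (!-+R (SpanR.single c a) (SpanR.single c a') g)
                  (trans (cong₂ _+_ (lookup∘tabulate _ g) (lookup∘tabulate _ g)) (split (toℕ c ≡ᵇ toℕ g)))))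
      where
      split : ∀ b → (if b then a else 0#) + (if b then a' else 0#) ≡ (if b then a + a' else 0#)
      split true  = refl
      split false = +-identityˡ 0#

    additive : (Z : R p → Ũ₅ p) → Z 0R ≡ e → (∀ x y → Z x · Z y ≡ Z (x +ᵣ y)) →
               (∀ c → InGen (Z (δR c))) → ∀ x → InGen (Z x)
    additive Z Z0≡e Z-hom Zδ = SpanR.span p (InGen ∘ Z) (subst InGen (sym Z0≡e) InGen-e)
      (λ v w Gv Gw → subst InGen (Z-hom v w) (InGen-· Gv Gw)) multiples
      where
      multiples : ∀ c a → InGen (Z (SpanR.single c a))
      multiples c = cyclic (Z ∘ SpanR.single c) (trans (cong Z (single-0 c)) Z0≡e)
                           (λ a a' → trans (Z-hom _ _) (cong Z (sym (single-+ c a a')))) (Zδ c)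

    H₁ H₂ : U2 p → Ũ₅ p
    H₁ h = ⟪ 0M , 0R , h , 0R , 0# ⟫
    H₂ h = ⟪ 0M , 0R , 0# , 0R , h ⟫

    X Y : R p → Ũ₅ p
    X x = ⟪ 0M , x , 0# , 0R , 0# ⟫
    Y y = ⟪ 0M , 0R , 0# , y , 0# ⟫

    U : M p → Ũ₅ p
    U u = ⟪ u , 0R , 0# , 0R , 0# ⟫

    vanishing : ∀ {a b c d t} → a ≡ 0# → b ≡ 0# → c * d ≡ 0# → t ≡ 0# → (a + b) + c * d ≡ t
    vanishing refl refl cd≡0 t≡0 = trans (cong₂ _+_ (+-identityˡ 0#) cd≡0) (trans (+-identityˡ 0#) (sym t≡0))

    zero-x : ∀ g h → 0R ! g + 0R ! (g - h) ≡ 0R ! g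
    zero-x g h = trans (cong₂ _+_ (!-0R g) (!-0R (g - h))) (trans (+-identityˡ 0#) (sym (!-0R g)))

    zero-uˡ : ∀ g g' a b d → (0M ! g ! g' + 0M ! a ! b) + 0R ! g * d ≡ 0M ! g ! g'
    zero-uˡ g g' a b d = vanishing (!-0M g g') (!-0M a b) (trans (cong (_* d) (!-0R g)) (zeroˡ d)) (!-0M g g')

    zero-uʳ : ∀ g g' a b c b' → (0M ! g ! g' + 0M ! a ! b) + c * 0R ! b' ≡ 0M ! g ! g'
    zero-uʳ g g' a b c b' = vanishing (!-0M g g') (!-0M a b) (*-zero-by c (!-0R b')) (!-0M g g')

    x+0 : ∀ (x : R p) g a → x ! g + 0R ! a ≡ x ! g
    x+0 x g a = +-zero-by (x ! g) (!-0R a)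

    0+x : ∀ (x : R p) g → 0R ! g + x ! (g - 0#) ≡ x ! g
    0+x x g = trans (cong₂ _+_ (!-0R g) (cong (x !_) (sub-0 g))) (+-identityˡ _)

    ⊠-part : ∀ x y g g' a b → (0M ! g ! g' + 0M ! a ! b) + x ! g * y ! (g' - 0#) ≡ (x ⊗ᵣ y) ! g ! g'
    ⊠-part x y g g' a b = begin
      (0M ! g ! g' + 0M ! a ! b) + x ! g * y ! (g' - 0#)
        ≡⟨ zero-+ _ (trans (cong₂ _+_ (!-0M g g') (!-0M a b)) (+-identityˡ 0#)) ⟩
      x ! g * y ! (g' - 0#)
        ≡⟨ cong (λ c → x ! g * y ! c) (sub-0 g') ⟩
      x ! g * y ! g'
        ≡⟨ !-⊠ x y g g' ⟨
      (x ⊗ᵣ y) ! g ! g'                                   ∎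
      where open ≡-Reasoning

    H₁-hom : ∀ h h' → H₁ h · H₁ h' ≡ H₁ (h + h')
    H₁-hom h h' = ·-formula (λ g g' → zero-uˡ g g' _ _ _)
      (λ g → zero-x g h) refl (λ g → zero-x g 0#) (+-identityˡ 0#)

    H₂-hom : ∀ h h' → H₂ h · H₂ h' ≡ H₂ (h + h')
    H₂-hom h h' = ·-formula (λ g g' → zero-uˡ g g' _ _ _)
      (λ g → zero-x g 0#) (+-identityˡ 0#) (λ g → zero-x g h) refl

    X-hom : ∀ x x' → X x · X x' ≡ X (x +ᵣ x')
    X-hom x x' = ·-formula (λ g g' → zero-uʳ g g' _ _ _ _)
      (λ g → trans (cong (λ a → x ! g + x' ! a) (sub-0 g)) (sym (!-+R x x' g))) (+-identityˡ 0#)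
      (λ g → zero-x g 0#) (+-identityˡ 0#)

    Y-hom : ∀ y y' → Y y · Y y' ≡ Y (y +ᵣ y')
    Y-hom y y' = ·-formula (λ g g' → zero-uˡ g g' _ _ _) (λ g → zero-x g 0#) (+-identityˡ 0#)
      (λ g → trans (cong (λ a → y ! g + y' ! a) (sub-0 g)) (sym (!-+R y y' g))) (+-identityˡ 0#)

    U-hom : ∀ u u' → U u · U u' ≡ U (u +ₘ u')
    U-hom u u' = ·-formula u-part (λ g → zero-x g 0#) (+-identityˡ 0#) (λ g → zero-x g 0#) (+-identityˡ 0#)
      where
      u-part : ∀ g g' → (u ! g ! g' + u' ! (g - 0#) ! (g' - 0#)) + 0R ! g * 0R ! (g' - 0#) ≡ (u +ₘ u') ! g ! g'
      u-part g g' = begin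
        (u ! g ! g' + u' ! (g - 0#) ! (g' - 0#)) + 0R ! g * 0R ! (g' - 0#)
          ≡⟨ +-zero-by _ (*-zero-by (0R ! g) (!-0R _)) ⟩
        u ! g ! g' + u' ! (g - 0#) ! (g' - 0#)
          ≡⟨ cong₂ (λ a b → u ! g ! g' + u' ! a ! b) (sub-0 g) (sub-0 g') ⟩
        u ! g ! g' + u' ! g ! g'
          ≡⟨ !-+M u u' g g' ⟨
        (u +ₘ u') ! g ! g' ∎
        where open ≡-Reasoning

    X-conj : ∀ h x → (H₁ h · X x) · H₁ (- h) ≡ X (h ▷ᵣ x)
    X-conj h x = trans (cong (_· H₁ (- h)) translate) untranslate
      where
      translate : H₁ h · X x ≡ ⟪ 0M , (h ▷ᵣ x) , h , 0R , 0# ⟫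
      translate = ·-formula (λ g g' → zero-uˡ g g' _ _ _)
        (λ g → trans (cong (_+ x ! (g - h)) (!-0R g)) (trans (+-identityˡ _) (sym (!-▷R h x g))))
        (+-identityʳ h) (λ g → zero-x g 0#) (+-identityˡ 0#)
      untranslate : ⟪ 0M , (h ▷ᵣ x) , h , 0R , 0# ⟫ · H₁ (- h) ≡ X (h ▷ᵣ x)
      untranslate = ·-formula (λ g g' → zero-uʳ g g' _ _ _ _) (λ g → x+0 (h ▷ᵣ x) g (g - h))
        (-‿inverseʳ h) (λ g → zero-x g 0#) (+-identityˡ 0#)

    Y-conj : ∀ h y → (H₂ h · Y y) · H₂ (- h) ≡ Y (h ▷ᵣ y)
    Y-conj h y = trans (cong (_· H₂ (- h)) translate) untranslate
      where
      translate : H₂ h · Y y ≡ ⟪ 0M , 0R , 0# , (h ▷ᵣ y) , h ⟫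
      translate = ·-formula (λ g g' → zero-uˡ g g' _ _ _) (λ g → zero-x g 0#) (+-identityˡ 0#)
        (λ g → trans (cong (_+ y ! (g - h)) (!-0R g)) (trans (+-identityˡ _) (sym (!-▷R h y g))))
        (+-identityʳ h)
      untranslate : ⟪ 0M , 0R , 0# , (h ▷ᵣ y) , h ⟫ · H₂ (- h) ≡ Y (h ▷ᵣ y)
      untranslate = ·-formula (λ g g' → zero-uˡ g g' _ _ _) (λ g → zero-x g 0#) (+-identityˡ 0#)
        (λ g → x+0 (h ▷ᵣ y) g (g - h)) (-‿inverseʳ h)

    δR-translate : ∀ h c → (h ▷ᵣ (δR c)) ≡ δR (c + h)
    δR-translate h c = vec-ext λ g → begin
      (h ▷ᵣ (δR c)) ! g           ≡⟨ trans (!-▷R h (δR c) g) (!-δR c (g - h)) ⟩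
      δ c (g - h)                   ≡⟨ cong (λ z → δ z (g - h)) (add-sub c h) ⟨
      δ ((c + h) - h) (g - h)       ≡⟨ δ-shift (c + h) (g - h) h ⟨
      δ (c + h) ((g - h) + h)       ≡⟨ cong (δ (c + h)) (sub-add g h) ⟩
      δ (c + h) g                   ≡⟨ !-δR (c + h) g ⟨
      δR (c + h) ! g                ∎
      where open ≡-Reasoning

    H₁-all : ∀ h → InGen (H₁ h)
    H₁-all = cyclic H₁ refl H₁-hom (subst (Gen p) (sym φ-g₁) (gen zero))

    H₂-all : ∀ h → InGen (H₂ h)
    H₂-all = cyclic H₂ refl H₂-hom (subst (Gen p) (sym φ-g₄) (gen (suc (suc (suc zero)))))

    -- x is spanned by the translates of g₂ = X (δR 0), y by those of g₃ = Y (δR last).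
    X-all : ∀ x → InGen (X x)
    X-all = additive X refl X-hom λ c →
      subst InGen (trans (X-conj c (δR 0#)) (cong X (trans (δR-translate c 0#) (cong δR (+-identityˡ c)))))
        (InGen-· (InGen-· (H₁-all c) (subst (Gen p) (sym φ-g₂) (gen (suc zero)))) (H₁-all (- c)))

    Y-all : ∀ y → InGen (Y y)
    Y-all = additive Y refl Y-hom λ c →
      subst InGen (trans (Y-conj (c - last) (δR last)) (cong Y (translated c)))
        (InGen-· (InGen-· (H₂-all (c - last)) (subst (Gen p) (sym φ-g₃) (gen (suc (suc zero)))))
                 (H₂-all (- (c - last))))
      where
      translated : ∀ c → (c - last) ▷ᵣ δR last ≡ δR c
      translated c = trans (δR-translate (c - last) last) (cong δR (trans (+-comm last _) (sub-add c last)))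

    -- X x · Y y = (x ⊗ y, x, 0, y, 0), and the commutator-like product
    -- (X x Y y)(X (-x) Y (-y)) is U (x ⊗ y).
    X·Y : ∀ x y → X x · Y y ≡ ⟪ x ⊗ᵣ y , x , 0# , y , 0# ⟫
    X·Y x y = ·-formula (λ g g' → ⊠-part x y g g' (g - 0#) (g' - 0#))
      (λ g → x+0 x g (g - 0#)) (+-identityˡ 0#) (0+x y) (+-identityˡ 0#)

    negR : R p → R p
    negR x = tabulate λ g → - (x ! g)

    !-negR : ∀ x g → negR x ! g ≡ - (x ! g)
    !-negR x = lookup∘tabulate _

    commutator : ∀ x y →
      ⟪ x ⊗ᵣ y , x , 0# , y , 0# ⟫ · ⟪ negR x ⊗ᵣ negR y , negR x , 0# , negR y , 0# ⟫ ≡ U (x ⊗ᵣ y)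
    commutator x y = ·-formula u-part (λ g → x-part x g) (+-identityˡ 0#) (λ g → x-part y g) (+-identityˡ 0#)
      where
      open ≡-Reasoning
      x⁻ = negR x
      y⁻ = negR y
      x-part : ∀ x g → x ! g + negR x ! (g - 0#) ≡ 0R ! g
      x-part x g = trans (cong (x ! g +_) (trans (cong (negR x !_) (sub-0 g)) (!-negR x g)))
                         (trans (-‿inverseʳ _) (sym (!-0R g)))
      cancel : ∀ a b → (a * b + (- a) * (- b)) + a * (- b) ≡ a * b
      cancel a b = begin
        (a * b + (- a) * (- b)) + a * (- b)    ≡⟨ +-assoc (a * b) _ _ ⟩
        a * b + ((- a) * (- b) + a * (- b))    ≡⟨ cong (a * b +_) (distribʳ (- b) (- a) a) ⟨
        a * b + (- a + a) * (- b)              ≡⟨ cong (λ z → a * b + z * (- b)) (-‿inverseˡ a) ⟩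
        a * b + 0# * (- b)                     ≡⟨ +-zero-by (a * b) (zeroˡ (- b)) ⟩
        a * b                                  ∎
      u-part : ∀ g g' → ((x ⊗ᵣ y) ! g ! g' + (x⁻ ⊗ᵣ y⁻) ! (g - 0#) ! (g' - 0#)) + x ! g * y⁻ ! (g' - 0#)
                        ≡ (x ⊗ᵣ y) ! g ! g'
      u-part g g' = begin
        ((x ⊗ᵣ y) ! g ! g' + (x⁻ ⊗ᵣ y⁻) ! (g - 0#) ! (g' - 0#)) + x ! g * y⁻ ! (g' - 0#)
          ≡⟨ cong₂ (λ a b → ((x ⊗ᵣ y) ! g ! g' + (x⁻ ⊗ᵣ y⁻) ! a ! b) + x ! g * y⁻ ! b) (sub-0 g) (sub-0 g') ⟩
        ((x ⊗ᵣ y) ! g ! g' + (x⁻ ⊗ᵣ y⁻) ! g ! g') + x ! g * y⁻ ! g'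
          ≡⟨ cong₂ (λ a b → (a + b) + x ! g * y⁻ ! g') (!-⊠ x y g g')
                   (trans (!-⊠ x⁻ y⁻ g g') (cong₂ _*_ (!-negR x g) (!-negR y g'))) ⟩
        (x ! g * y ! g' + (- (x ! g)) * (- (y ! g'))) + x ! g * y⁻ ! g'
          ≡⟨ cong (λ b → (x ! g * y ! g' + (- (x ! g)) * (- (y ! g'))) + x ! g * b) (!-negR y g') ⟩
        (x ! g * y ! g' + (- (x ! g)) * (- (y ! g'))) + x ! g * (- (y ! g'))
          ≡⟨ cancel (x ! g) (y ! g') ⟩
        x ! g * y ! g'
          ≡⟨ !-⊠ x y g g' ⟨
        (x ⊗ᵣ y) ! g ! g' ∎

    U⊠-all : ∀ x y → InGen (U (x ⊗ᵣ y))
    U⊠-all x y = subst InGen (commutator x y)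
      (InGen-· (subst InGen (X·Y x y) (InGen-· (X-all x) (Y-all y)))
               (subst InGen (X·Y (negR x) (negR y)) (InGen-· (X-all (negR x)) (Y-all (negR y)))))

    -- u is spanned by its rows, and the u with a single nonzero row r in
    -- row c is δR c ⊗ r.
    +R-identityˡ : ∀ r → (0R +ᵣ r) ≡ r
    +R-identityˡ r = vec-ext λ g → trans (!-+R 0R r g) (trans (cong (_+ r ! g) (!-0R g)) (+-identityˡ _))

    +R-identityʳ : ∀ r → (r +ᵣ 0R) ≡ r
    +R-identityʳ r = vec-ext λ g → trans (!-+R r 0R g) (x+0 r g g)

    module SpanM = Span 0R _+ᵣ_ +R-identityˡ +R-identityʳ

    single-row : ∀ c r → ((δR c) ⊗ᵣ r) ≡ SpanM.single c r
    single-row c r = M-ext λ g g' → begin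
      ((δR c) ⊗ᵣ r) ! g ! g'                 ≡⟨ trans (!-⊠ (δR c) r g g') (cong (_* r ! g') (!-δR c g)) ⟩
      δ c g * r ! g'                          ≡⟨ row (toℕ c ≡ᵇ toℕ g) g' ⟩
      (if toℕ c ≡ᵇ toℕ g then r else 0R) ! g' ≡⟨ cong (_! g') (lookup∘tabulate _ g) ⟨
      SpanM.single c r ! g ! g'               ∎
      where
      open ≡-Reasoning
      row : ∀ b g' → (if b then 1# else 0#) * r ! g' ≡ (if b then r else 0R) ! g'
      row true  g' = *-identityˡ _
      row false g' = trans (zeroˡ _) (sym (!-0R g'))

    U-all : ∀ u → InGen (U u)
    U-all = SpanM.span p (InGen ∘ U) InGen-e (λ v w Gv Gw → subst InGen (U-hom v w) (InGen-· Gv Gw))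
                       (λ c r → subst (InGen ∘ U) (single-row c r) (U⊠-all (δR c) r))

    infixl 6 _-M_
    _-M_ : M p → M p → M p
    u -M w = tabulate λ g → tabulate λ g' → u ! g ! g' - w ! g ! g'

    !--M : ∀ u w g g' → (u -M w) ! g ! g' ≡ u ! g ! g' - w ! g ! g'
    !--M u w g g' = trans (cong (_! g') (lookup∘tabulate _ g)) (lookup∘tabulate _ g')

    decomposition : ∀ u x₁ h₁ x₂ h₂ →
      U (u -M x₁ ⊗ᵣ x₂) · ((X x₁ · H₁ h₁) · (Y x₂ · H₂ h₂))
        ≡ ⟪ u , x₁ , h₁ , x₂ , h₂ ⟫
    decomposition u x₁ h₁ x₂ h₂ = begin
      U (u -M w) · ((X x₁ · H₁ h₁) · (Y x₂ · H₂ h₂))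
        ≡⟨ cong (λ z → U (u -M w) · z) (cong₂ _·_ X·H Y·H) ⟩
      U (u -M w) · (⟪ 0M , x₁ , h₁ , 0R , 0# ⟫ · ⟪ 0M , 0R , 0# , x₂ , h₂ ⟫)
        ≡⟨ cong (U (u -M w) ·_) XH·YH ⟩
      U (u -M w) · ⟪ w , x₁ , h₁ , x₂ , h₂ ⟫
        ≡⟨ ·-formula u-part (0+x x₁) (+-identityˡ h₁) (0+x x₂) (+-identityˡ h₂) ⟩
      ⟪ u , x₁ , h₁ , x₂ , h₂ ⟫ ∎
      where
      open ≡-Reasoning
      w = (x₁ ⊗ᵣ x₂)
      X·H : X x₁ · H₁ h₁ ≡ ⟪ 0M , x₁ , h₁ , 0R , 0# ⟫
      X·H = ·-formula (λ g g' → zero-uʳ g g' _ _ _ _) (λ g → x+0 x₁ g (g - 0#)) (+-identityˡ h₁)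
                      (λ g → zero-x g 0#) (+-identityˡ 0#)
      Y·H : Y x₂ · H₂ h₂ ≡ ⟪ 0M , 0R , 0# , x₂ , h₂ ⟫
      Y·H = ·-formula (λ g g' → zero-uˡ g g' _ _ _) (λ g → zero-x g 0#) (+-identityˡ 0#)
                      (λ g → x+0 x₂ g (g - 0#)) (+-identityˡ h₂)
      XH·YH : ⟪ 0M , x₁ , h₁ , 0R , 0# ⟫ · ⟪ 0M , 0R , 0# , x₂ , h₂ ⟫
            ≡ ⟪ w , x₁ , h₁ , x₂ , h₂ ⟫
      XH·YH = ·-formula (λ g g' → ⊠-part x₁ x₂ g g' (g - h₁) (g' - 0#))
        (λ g → x+0 x₁ g (g - h₁)) (+-identityʳ h₁) (0+x x₂) (+-identityˡ h₂)
      u-part : ∀ g g' → ((u -M w) ! g ! g' + w ! (g - 0#) ! (g' - 0#)) + 0R ! g * x₂ ! (g' - 0#) ≡ u ! g ! g'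
      u-part g g' = begin
        ((u -M w) ! g ! g' + w ! (g - 0#) ! (g' - 0#)) + 0R ! g * x₂ ! (g' - 0#)
          ≡⟨ +-zero-by _ (trans (cong (_* x₂ ! (g' - 0#)) (!-0R g)) (zeroˡ _)) ⟩
        (u -M w) ! g ! g' + w ! (g - 0#) ! (g' - 0#)
          ≡⟨ cong₂ (λ a b → a + w ! b ! (g' - 0#)) (!--M u w g g') (sub-0 g) ⟩
        (u ! g ! g' - w ! g ! g') + w ! g ! (g' - 0#)
          ≡⟨ cong (λ b → (u ! g ! g' - w ! g ! g') + w ! g ! b) (sub-0 g') ⟩
        (u ! g ! g' - w ! g ! g') + w ! g ! g'
          ≡⟨ sub-add _ _ ⟩
        u ! g ! g' ∎

    image⇒Gen : ∀ a → InGen a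
    image⇒Gen (u , ((x₁ , h₁) , (x₂ , h₂))) = subst InGen (decomposition u x₁ h₁ x₂ h₂)
      (InGen-· (U-all _) (InGen-· (InGen-· (X-all x₁) (H₁-all h₁)) (InGen-· (Y-all x₂) (H₂-all h₂))))

proposition6p5 : (p : ℕ) .{{nz : NonZero p}} → Prime p →
    Σ (Ũ₅ p → Mat p (N p)) λ φ →
      (∀ a b → φ (_·Ũ_ p a b) ≡ _⊗_ p (φ a) (φ b))
      × (∀ a b → φ a ≡ φ b → a ≡ b)
      × (∀ X → Gen p X ⇔ ∃ λ a → φ a ≡ X)
proposition6p5 p p-prime =
  φ p , φ-hom p , φ-injective p (1<p p p-prime) ,
  λ X → mk⇔ (Gen⇒image p p-prime) (λ { (a , φa≡X) → subst (Gen p) φa≡X (image⇒Gen p p-prime a) })
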